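{- Let $K$ be an imaginary quadratic field with ring of integers $\mathcal{O}_K$, let $\ell$ be an odd rational prime unramified in $K$, let $a$ be a positive integer and $k$ an integer coprime to $\ell$. Set $N=\#\{g\in(\mathcal{O}_K/\ell^a\mathcal{O}_K)^\times:\det(g-1)\not\equiv0\pmod\ell,\ \det g\equiv k\pmod{\ell^a}\}$. If $\ell$ splits in $K$, then $N=\ell^{a-1}(\ell-2)$ if $k\equiv1\pmod\ell$ and $N=\ell^{a-1}(\ell-3)$ if $k\not\equiv1\pmod\ell$. If $\ell$ is inert in $K$, then $N=\ell^a$ if $k\equiv1\pmod\ell$ and $N=\ell^{a-1}(\ell+1)$ if $k\not\equiv1\pmod\ell$.
   Context: For $g\in\mathcal{O}_K/\ell^a\mathcal{O}_K$, $\det g\in\mathbb{Z}/\ell^a\mathbb{Z}$ denotes the determinant of multiplication by $g$ viewed as a $\mathbb{Z}/\ell^a\mathbb{Z}$-linear endomorphism of the free rank-2 module $\mathcal{O}_K/\ell^a\mathcal{O}_K$ (equivalently, the reduction of the norm); it is independent of the choice of basis. -}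

module Defs where

open import Data.Nat as ℕ using (ℕ; NonZero; _^_)
open import Data.Nat.Properties using (m^n≢0)
open import Data.Integer as ℤ using (ℤ; +_; _+_; _-_; _*_; -_; ∣_∣; _%ℕ_; _/ℕ_)
open import Data.Integer.Divisibility as ℤ∣ using ()
open import Data.Product using (_×_; _,_; proj₁; proj₂; ∃)
open import Data.Sum using (_⊎_)
open import Data.Fin using (Fin; toℕ)
open import Data.Fin.Properties using (any?)
open import Data.List using (List; length; filter; allFin; cartesianProduct)
open import Relation.Nullary using (¬_; Dec)
open import Relation.Nullary.Decidable using (_×-dec_; ¬?)
open import Relation.Binary.PropositionalEquality using (_≡_)
open import Relation.Unary using (Decidable)
open import Data.Bool using (if_then_else_)

-- Imaginary quadratic fields K = ℚ(√d), d a negative squarefree integer.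

SquareFree : ℤ → Set
SquareFree d = ∀ (n : ℕ) → (n ℕ.* n) Data.Nat.Divisibility.∣ ∣ d ∣ → n ≡ 1
  where import Data.Nat.Divisibility

ImagQuadratic : ℤ → Set
ImagQuadratic d = d ℤ.< + 0 × SquareFree d

-- O_K = ℤ ⊕ ℤω with ω = √d if d ≢ 1 (mod 4) and ω = (1 + √d)/2 if d ≡ 1 (mod 4).
-- In both cases ω² = sω + c with
--   (s , c) = (1 , (d - 1)/4)  if d ≡ 1 mod 4,
--   (s , c) = (0 , d)          otherwise.
isOneMod4 : ℤ → Data.Bool.Bool
isOneMod4 d = (d %ℕ 4) ℕ.≡ᵇ 1
  where import Data.Bool

ωs : ℤ → ℤ
ωs d = if isOneMod4 d then + 1 else + 0

ωc : ℤ → ℤ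
ωc d = if isOneMod4 d then (d - + 1) /ℕ 4 else d

-- An element x + yω of O_K, written in the ℤ-basis (1 , ω).
OK : Set
OK = ℤ × ℤ

one : OK
one = (+ 1 , + 0)

mulO : ℤ → OK → OK → OK
mulO d (x₁ , y₁) (x₂ , y₂) =
  ( x₁ * x₂ + ωc d * y₁ * y₂
  , x₁ * y₂ + x₂ * y₁ + ωs d * y₁ * y₂ )

subO : OK → OK → OK
subO (x₁ , y₁) (x₂ , y₂) = (x₁ - x₂ , y₁ - y₂)

-- determinant of multiplication by x + yω on the basis (1 , ω)
-- (matrix [[x , c y] , [y , x + s y]]), i.e. the norm.
detO : ℤ → OK → ℤ
detO d (x , y) = x * (x + ωs d * y) - ωc d * y * y

_∣O_ : ℕ → OK → Set
ℓ ∣O (x , y) = (+ ℓ ℤ∣.∣ x) × (+ ℓ ℤ∣.∣ y)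

-- Decomposition of a rational prime ℓ in K (ideal-theoretically):
-- ℓ unramified  ⇔ ℓO_K is a radical ideal (squarefree factorisation);
-- ℓ inert       ⇔ ℓO_K is a prime ideal;
-- ℓ split       ⇔ ℓO_K is a product of two distinct primes, which for a
--                 quadratic field means: unramified and not inert.

Unramified : ℤ → ℕ → Set
Unramified d ℓ = ∀ (α : OK) → ℓ ∣O mulO d α α → ℓ ∣O α

Inert : ℤ → ℕ → Set
Inert d ℓ = ∀ (α β : OK) → ℓ ∣O mulO d α β → ℓ ∣O α ⊎ ℓ ∣O β

Splits : ℤ → ℕ → Set
Splits d ℓ = Unramified d ℓ × ¬ Inert d ℓ

-- The finite ring O_K / m O_K, elements represented by pairs of residues
-- (x , y) ∈ {0..m-1}², standing for x + yω.

Res : ℕ → Set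
Res m = Fin m × Fin m

toOK : ∀ {m} → Res m → OK
toOK (x , y) = (+ toℕ x , + toℕ y)

infix 4 _≡[_]_ _≡O[_]_
_≡[_]_ : ℤ → (m : ℕ) → .{{NonZero m}} → ℤ → Set
u ≡[ m ] v = (u - v) %ℕ m ≡ 0

_≡O[_]_ : OK → (m : ℕ) → .{{NonZero m}} → OK → Set
(x₁ , y₁) ≡O[ m ] (x₂ , y₂) = (x₁ ≡[ m ] x₂) × (y₁ ≡[ m ] y₂)

IsUnit : ℤ → (m : ℕ) → .{{NonZero m}} → Res m → Set
IsUnit d m g = ∃ λ (h₁ : Fin m) → ∃ λ (h₂ : Fin m) →
  mulO d (toOK g) (toOK (h₁ , h₂)) ≡O[ m ] one

Cond : ℤ → (ℓ a : ℕ) → .{{NonZero ℓ}} → ℤ → Res (ℓ ^ a) → Set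
Cond d ℓ a k g =
  IsUnit d (ℓ ^ a) {{m^n≢0 ℓ a}} g
  × ¬ (detO d (subO (toOK g) one) ≡[ ℓ ] + 0)
  × (_≡[_]_ (detO d (toOK g)) (ℓ ^ a) {{m^n≢0 ℓ a}} k)

private
  ≡?ℤ : ∀ u m .{{_ : NonZero m}} v → Dec (u ≡[ m ] v)
  ≡?ℤ u m v = ((u - v) %ℕ m) ℕ.≟ 0

  ≡O? : ∀ α m .{{_ : NonZero m}} β → Dec (α ≡O[ m ] β)
  ≡O? (x₁ , y₁) m (x₂ , y₂) = ≡?ℤ x₁ m x₂ ×-dec ≡?ℤ y₁ m y₂

  unit? : ∀ d m .{{_ : NonZero m}} → Decidable (IsUnit d m)
  unit? d m g = any? (λ h₁ → any? (λ h₂ → ≡O? (mulO d (toOK g) (toOK (h₁ , h₂))) m one))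

cond? : ∀ d ℓ a .{{_ : NonZero ℓ}} k → Decidable (Cond d ℓ a k)
cond? d ℓ a k g =
  unit? d (ℓ ^ a) {{m^n≢0 ℓ a}} g
  ×-dec ¬? (≡?ℤ (detO d (subO (toOK g) one)) ℓ (+ 0))
  ×-dec ≡?ℤ (detO d (toOK g)) (ℓ ^ a) {{m^n≢0 ℓ a}} k

countN : (d : ℤ) (ℓ a : ℕ) .{{_ : NonZero ℓ}} (k : ℤ) → ℕ
countN d ℓ a k =
  length (filter (cond? d ℓ a k) (cartesianProduct (allFin (ℓ ^ a)) (allFin (ℓ ^ a))))

-- Write g = x + y ω with ω² = s ω + c, so that det g = N (x , y) = x (x + s y) - c y² and
-- det (g - 1) = N (x - 1 , y).  A residue of norm k is automatically a unit, so we count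
-- solutions of N (x , y) ≡ k mod ℓᵃ with N (x - 1 , y) ≢ 0 mod ℓ.  As ℓ ∤ disc = s² + 4c, the
-- gradient of N does not vanish mod ℓ on N = k, so by Hensel each solution mod ℓᵇ has exactly ℓ
-- lifts mod ℓᵇ⁺¹, and the count is ℓᵃ⁻¹ times the number of solutions mod ℓ.
-- Modulo ℓ: if ℓ splits, t² - s t - c has a root r and N (x , y) ≡ (x + r y) (x + (s - r) y),
-- turning the count into #{u v = k, u ≠ 1, v ≠ 1}.  If ℓ is inert, N is anisotropic and onto the
-- units, so every unit is represented equally often, namely ℓ + 1 times since 1 + (ℓ - 1)(ℓ + 1) = ℓ²;
-- among the representations of k, only g = 1 violates det (g - 1) ≢ 0, and it has norm k exactly when k ≡ 1.
module Submission where

module FiniteSum where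

  open import Data.Nat
  open import Data.Nat.Properties
  open import Data.Nat.DivMod
  open import Data.Fin using (Fin; toℕ; fromℕ<)
  import Data.Fin.Properties as Finₚ
  open import Data.Fin.Permutation using (Permutation; permutation)
  open import Data.Empty using (⊥-elim)
  open import Data.Product using (_×_; proj₁; proj₂)
  open import Relation.Binary.PropositionalEquality
  open import Relation.Nullary using (Dec; yes; no; ¬_)
  open import Relation.Nullary.Decidable using (_×-dec_; ¬?)
  import Algebra.Properties.CommutativeMonoid.Sum as MonoidSum

  ∑ : ℕ → (ℕ → ℕ) → ℕ
  ∑ zero    f = 0
  ∑ (suc n) f = f 0 + ∑ n (λ i → f (suc i))

  ∑² : ℕ → (ℕ → ℕ → ℕ) → ℕ
  ∑² n F = ∑ n (λ x → ∑ n (λ y → F x y))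

  𝟙 : ∀ {p} {P : Set p} → Dec P → ℕ
  𝟙 (yes _) = 1
  𝟙 (no _)  = 0

  ∑-cong : ∀ n {f g : ℕ → ℕ} → (∀ i → i < n → f i ≡ g i) → ∑ n f ≡ ∑ n g
  ∑-cong zero    f≡g = refl
  ∑-cong (suc n) f≡g = cong₂ _+_ (f≡g 0 z<s) (∑-cong n (λ i i<n → f≡g (suc i) (s<s i<n)))

  ∑-+ : ∀ n (f g : ℕ → ℕ) → ∑ n (λ i → f i + g i) ≡ ∑ n f + ∑ n g
  ∑-+ zero    f g = refl
  ∑-+ (suc n) f g rewrite ∑-+ n (λ i → f (suc i)) (λ i → g (suc i)) =
    +-assoc-middle (f 0) (g 0) (∑ n (λ i → f (suc i))) (∑ n (λ i → g (suc i)))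
    where
    +-assoc-middle : ∀ a b c d → a + b + (c + d) ≡ a + c + (b + d)
    +-assoc-middle a b c d = begin
      a + b + (c + d)   ≡⟨ +-assoc a b (c + d) ⟩
      a + (b + (c + d)) ≡⟨ cong (a +_) (+-comm b (c + d)) ⟩
      a + (c + d + b)   ≡⟨ cong (a +_) (+-assoc c d b) ⟩
      a + (c + (d + b)) ≡⟨ cong (λ z → a + (c + z)) (+-comm d b) ⟩
      a + (c + (b + d)) ≡⟨ +-assoc a c (b + d) ⟨
      a + c + (b + d)   ∎
      where open ≡-Reasoning

  ∑-*ˡ : ∀ n c (f : ℕ → ℕ) → ∑ n (λ i → c * f i) ≡ c * ∑ n f
  ∑-*ˡ zero    c f = sym (*-zeroʳ c)
  ∑-*ˡ (suc n) c f rewrite ∑-*ˡ n c (λ i → f (suc i)) = sym (*-distribˡ-+ c (f 0) _)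

  ∑-const : ∀ n c → ∑ n (λ _ → c) ≡ n * c
  ∑-const zero    c = refl
  ∑-const (suc n) c = cong (c +_) (∑-const n c)

  ∑-zero : ∀ n (f : ℕ → ℕ) → (∀ i → i < n → f i ≡ 0) → ∑ n f ≡ 0
  ∑-zero n f f≡0 = trans (∑-cong n f≡0) (trans (∑-const n 0) (*-zeroʳ n))

  ∑-++ : ∀ m n f → ∑ (m + n) f ≡ ∑ m f + ∑ n (λ i → f (m + i))
  ∑-++ zero    n f = refl
  ∑-++ (suc m) n f rewrite ∑-++ m n (λ i → f (suc i)) = sym (+-assoc (f 0) _ _)

  ∑-blocks : ∀ k m f → ∑ (k * m) f ≡ ∑ k (λ t → ∑ m (λ x → f (t * m + x)))
  ∑-blocks zero    m f = refl
  ∑-blocks (suc k) m f = begin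
    ∑ (m + k * m) f                                      ≡⟨ ∑-++ m (k * m) f ⟩
    ∑ m f + ∑ (k * m) (λ i → f (m + i))                  ≡⟨ cong (∑ m f +_) (∑-blocks k m (λ i → f (m + i))) ⟩
    ∑ m f + ∑ k (λ t → ∑ m (λ x → f (m + (t * m + x))))  ≡⟨ cong (∑ m f +_) (∑-cong k (λ t _ → ∑-cong m (λ x _ →
                                                              cong f (sym (+-assoc m (t * m) x))))) ⟩
    ∑ m f + ∑ k (λ t → ∑ m (λ x → f (m + t * m + x)))    ∎
    where open ≡-Reasoning

  ∑-swap : ∀ m n (f : ℕ → ℕ → ℕ) → ∑ m (λ i → ∑ n (f i)) ≡ ∑ n (λ j → ∑ m (λ i → f i j))
  ∑-swap zero    n f = sym (∑-zero n _ (λ _ _ → refl))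
  ∑-swap (suc m) n f = begin
    ∑ n (f 0) + ∑ m (λ i → ∑ n (f (suc i)))          ≡⟨ cong (∑ n (f 0) +_) (∑-swap m n (λ i → f (suc i))) ⟩
    ∑ n (f 0) + ∑ n (λ j → ∑ m (λ i → f (suc i) j))  ≡⟨ ∑-+ n (f 0) _ ⟨
    ∑ n (λ j → f 0 j + ∑ m (λ i → f (suc i) j))      ∎
    where open ≡-Reasoning

  ∑-point : ∀ n (f : ℕ → ℕ) j → j < n → (∀ i → i < n → i ≢ j → f i ≡ 0) → ∑ n f ≡ f j
  ∑-point (suc n) f zero    j<n f≡0 =
    trans (cong (f 0 +_) (∑-zero n _ (λ i i<n → f≡0 (suc i) (s<s i<n) (λ ())))) (+-identityʳ (f 0))
  ∑-point (suc n) f (suc j) (s<s j<n) f≡0 =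
    trans (cong (_+ ∑ n (λ i → f (suc i))) (f≡0 0 z<s (λ ())))
      (∑-point n (λ i → f (suc i)) j j<n (λ i i<n i≢j → f≡0 (suc i) (s<s i<n) (λ e → i≢j (suc-injective e))))

  𝟙-yes : ∀ {p} {P : Set p} (P? : Dec P) → P → 𝟙 P? ≡ 1
  𝟙-yes (yes _) _  = refl
  𝟙-yes (no ¬p) p = ⊥-elim (¬p p)

  𝟙-no : ∀ {p} {P : Set p} (P? : Dec P) → ¬ P → 𝟙 P? ≡ 0
  𝟙-no (yes p) ¬p = ⊥-elim (¬p p)
  𝟙-no (no _)  _  = refl

  𝟙-cong : ∀ {p q} {P : Set p} {Q : Set q} (P? : Dec P) (Q? : Dec Q) → (P → Q) → (Q → P) → 𝟙 P? ≡ 𝟙 Q?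
  𝟙-cong (yes p) (yes q) _ _ = refl
  𝟙-cong (yes p) (no ¬q) f _ = ⊥-elim (¬q (f p))
  𝟙-cong (no ¬p) (yes q) _ g = ⊥-elim (¬p (g q))
  𝟙-cong (no ¬p) (no ¬q) _ _ = refl

  𝟙-¬+𝟙 : ∀ {p} {P : Set p} (P? : Dec P) → 𝟙 (¬? P?) + 𝟙 P? ≡ 1
  𝟙-¬+𝟙 (yes _) = refl
  𝟙-¬+𝟙 (no _)  = refl

  𝟙-×¬+𝟙-× : ∀ {P Q : Set} (P? : Dec P) (Q? : Dec Q) → 𝟙 (P? ×-dec ¬? Q?) + 𝟙 (P? ×-dec Q?) ≡ 𝟙 P?
  𝟙-×¬+𝟙-× (yes _) (yes _) = refl
  𝟙-×¬+𝟙-× (yes _) (no _)  = refl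
  𝟙-×¬+𝟙-× (no _)  (yes _) = refl
  𝟙-×¬+𝟙-× (no _)  (no _)  = refl

  ∑-𝟙-unique : ∀ n {P : ℕ → Set} (P? : ∀ i → Dec (P i)) j → j < n → P j →
               (∀ i → i < n → P i → i ≡ j) → ∑ n (λ i → 𝟙 (P? i)) ≡ 1
  ∑-𝟙-unique n P? j j<n pj unique =
    trans (∑-point n _ j j<n (λ i i<n i≢j → 𝟙-no (P? i) (λ pi → i≢j (unique i i<n pi)))) (𝟙-yes (P? j) pj)

  ∑-𝟙-¬ : ∀ n {P : ℕ → Set} (P? : ∀ i → Dec (P i)) →
          ∑ n (λ i → 𝟙 (¬? (P? i))) + ∑ n (λ i → 𝟙 (P? i)) ≡ n
  ∑-𝟙-¬ n P? = trans (sym (∑-+ n _ _))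
    (trans (∑-cong n (λ i _ → 𝟙-¬+𝟙 (P? i))) (trans (∑-const n 1) (*-identityʳ n)))

  module ℕSum = MonoidSum +-0-commutativeMonoid

  ∑≡sum : ∀ n f → ∑ n f ≡ ℕSum.sum {n} (λ i → f (toℕ i))
  ∑≡sum zero    f = refl
  ∑≡sum (suc n) f = cong (f 0 +_) (∑≡sum n (λ i → f (suc i)))

  ∑-reindex : ∀ n (φ ψ : ℕ → ℕ) (f : ℕ → ℕ) →
              (∀ i → i < n → φ i < n) → (∀ i → i < n → ψ i < n) →
              (∀ i → i < n → ψ (φ i) ≡ i) → (∀ i → i < n → φ (ψ i) ≡ i) →
              ∑ n (λ i → f (φ i)) ≡ ∑ n f
  ∑-reindex n φ ψ f φ< ψ< ψφ φψ = begin
    ∑ n (λ i → f (φ i))                       ≡⟨ ∑≡sum n _ ⟩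
    ℕSum.sum {n} (λ i → f (φ (toℕ i)))        ≡⟨ ℕSum.sum-cong-≗ {n} (λ i → cong f (sym (Finₚ.toℕ-fromℕ< (φ< (toℕ i) (Finₚ.toℕ<n i))))) ⟩
    ℕSum.sum {n} (λ i → f (toℕ (φ′ i)))       ≡⟨ ℕSum.sum-permute (λ i → f (toℕ i)) π ⟨
    ℕSum.sum {n} (λ i → f (toℕ i))            ≡⟨ ∑≡sum n f ⟨
    ∑ n f                                     ∎
    where
    open ≡-Reasoning
    φ′ ψ′ : Fin n → Fin n
    φ′ i = fromℕ< (φ< (toℕ i) (Finₚ.toℕ<n i))
    ψ′ i = fromℕ< (ψ< (toℕ i) (Finₚ.toℕ<n i))
    inverse : ∀ {g h : ℕ → ℕ} (g< : ∀ i → i < n → g i < n) (h< : ∀ i → i < n → h i < n) →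
              (∀ i → i < n → g (h i) ≡ i) → ∀ i →
              fromℕ< (g< _ (Finₚ.toℕ<n (fromℕ< (h< (toℕ i) (Finₚ.toℕ<n i))))) ≡ i
    inverse {g} {h} g< h< gh i = Finₚ.toℕ-injective (trans (Finₚ.toℕ-fromℕ< _)
      (trans (cong g (Finₚ.toℕ-fromℕ< _)) (gh (toℕ i) (Finₚ.toℕ<n i))))
    π : Permutation n n
    π = permutation φ′ ψ′ (inverse φ< ψ< φψ) (inverse ψ< φ< ψφ)

  module _ (n : ℕ) .{{_ : NonZero n}} where

    private
      pair/ : ∀ t x → x < n → (t * n + x) / n ≡ t
      pair/ t x x<n = begin
        (t * n + x) / n   ≡⟨ +-distrib-/ (t * n) x (subst (_< n) (sym (trans (cong (_+ x % n) (m*n%n≡0 t n)) (m<n⇒m%n≡m x<n))) x<n) ⟩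
        t * n / n + x / n ≡⟨ cong₂ _+_ (m*n/n≡m t n) (m<n⇒m/n≡0 x<n) ⟩
        t + 0             ≡⟨ +-identityʳ t ⟩
        t                 ∎
        where open ≡-Reasoning

      pair% : ∀ t x → x < n → (t * n + x) % n ≡ x
      pair% t x x<n = trans (cong (_% n) (+-comm (t * n) x)) (trans ([m+kn]%n≡m%n x t n) (m<n⇒m%n≡m x<n))

      pair< : ∀ t x → t < n → x < n → t * n + x < n * n
      pair< t x t<n x<n = begin-strict
        t * n + x <⟨ +-monoʳ-< (t * n) x<n ⟩
        t * n + n ≡⟨ +-comm (t * n) n ⟩
        suc t * n ≤⟨ *-monoˡ-≤ n t<n ⟩
        n * n     ∎
        where open ≤-Reasoning

      unpair : ∀ i → i / n * n + i % n ≡ i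
      unpair i = trans (+-comm (i / n * n) (i % n)) (sym (m≡m%n+[m/n]*n i n))

    ∑²≡∑ : ∀ F → ∑² n F ≡ ∑ (n * n) (λ i → F (i / n) (i % n))
    ∑²≡∑ F = sym (trans (∑-blocks n n _) (∑-cong n (λ t _ → ∑-cong n (λ x x<n →
      cong₂ F (pair/ t x x<n) (pair% t x x<n)))))

    ∑²-reindex : ∀ (φ₁ φ₂ ψ₁ ψ₂ : ℕ → ℕ → ℕ) (F : ℕ → ℕ → ℕ) →
      (∀ x y → x < n → y < n → φ₁ x y < n × φ₂ x y < n) →
      (∀ x y → x < n → y < n → ψ₁ x y < n × ψ₂ x y < n) →
      (∀ x y → x < n → y < n → ψ₁ (φ₁ x y) (φ₂ x y) ≡ x × ψ₂ (φ₁ x y) (φ₂ x y) ≡ y) →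
      (∀ x y → x < n → y < n → φ₁ (ψ₁ x y) (ψ₂ x y) ≡ x × φ₂ (ψ₁ x y) (ψ₂ x y) ≡ y) →
      ∑² n (λ x y → F (φ₁ x y) (φ₂ x y)) ≡ ∑² n F
    ∑²-reindex φ₁ φ₂ ψ₁ ψ₂ F φ< ψ< ψφ φψ = begin
      ∑² n (λ x y → F (φ₁ x y) (φ₂ x y))  ≡⟨ ∑²≡∑ _ ⟩
      ∑ (n * n) (λ i → F (φ₁ (i / n) (i % n)) (φ₂ (i / n) (i % n)))
        ≡⟨ ∑-cong (n * n) (λ i i< → let p = φ< _ _ (m<n*o⇒m/o<n i<) (m%n<n i n) in
             sym (cong₂ F (pair/ (φ₁ (i / n) (i % n)) _ (proj₂ p)) (pair% (φ₁ (i / n) (i % n)) _ (proj₂ p)))) ⟩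
      ∑ (n * n) (λ i → G (Φ i))           ≡⟨ ∑-reindex (n * n) Φ Ψ G (lift< φ₁ φ₂ φ<) (lift< ψ₁ ψ₂ ψ<)
                                                 (lift-inverse ψ₁ ψ₂ φ₁ φ₂ φ< ψφ) (lift-inverse φ₁ φ₂ ψ₁ ψ₂ ψ< φψ) ⟩
      ∑ (n * n) G                         ≡⟨ ∑²≡∑ F ⟨
      ∑² n F                              ∎
      where
      open ≡-Reasoning
      G : ℕ → ℕ
      G j = F (j / n) (j % n)
      lift : (ℕ → ℕ → ℕ) → (ℕ → ℕ → ℕ) → ℕ → ℕ
      lift f₁ f₂ i = f₁ (i / n) (i % n) * n + f₂ (i / n) (i % n)
      Φ Ψ : ℕ → ℕ
      Φ = lift φ₁ φ₂
      Ψ = lift ψ₁ ψ₂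
      lift< : ∀ f₁ f₂ → (∀ x y → x < n → y < n → f₁ x y < n × f₂ x y < n) → ∀ i → i < n * n → lift f₁ f₂ i < n * n
      lift< f₁ f₂ f< i i< = let p = f< _ _ (m<n*o⇒m/o<n i<) (m%n<n i n) in pair< _ _ (proj₁ p) (proj₂ p)
      lift-inverse : ∀ g₁ g₂ f₁ f₂ → (∀ x y → x < n → y < n → f₁ x y < n × f₂ x y < n) →
        (∀ x y → x < n → y < n → g₁ (f₁ x y) (f₂ x y) ≡ x × g₂ (f₁ x y) (f₂ x y) ≡ y) →
        ∀ i → i < n * n → lift g₁ g₂ (lift f₁ f₂ i) ≡ i
      lift-inverse g₁ g₂ f₁ f₂ f< gf i i< =
        let p = f< _ _ (m<n*o⇒m/o<n i<) (m%n<n i n)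
            q = gf _ _ (m<n*o⇒m/o<n i<) (m%n<n i n) in
        trans (cong₂ (λ a b → g₁ a b * n + g₂ a b) (pair/ (f₁ (i / n) (i % n)) _ (proj₂ p)) (pair% (f₁ (i / n) (i % n)) _ (proj₂ p)))
          (trans (cong₂ (λ a b → a * n + b) (proj₁ q) (proj₂ q)) (unpair i))

module IntegerDivisibility where

  open import Data.Integer using (ℤ; +_; _+_; _-_; _*_; -_; ∣_∣; _⊖_; _%ℕ_; _/ℕ_)
  import Data.Integer.Properties as ℤₚ
  open import Data.Integer.DivMod using (a≡a%ℕn+[a/ℕn]*n; n%ℕd<d)
  open import Data.Integer.Divisibility.Signed
  open import Data.Nat as ℕ using (ℕ; zero; suc; NonZero)
  import Data.Nat.Properties as ℕₚ
  import Data.Nat.Divisibility as ℕ∣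
  open import Data.Nat.Primality using (Prime; euclidsLemma; prime⇒nonZero; ¬prime[1])
  open import Data.Nat.Coprimality using (Coprime; coprime-Bézout; prime⇒coprime)
  import Data.Nat.GCD as GCD
  open import Data.Integer.Tactic.RingSolver using (solve-∀)
  open import Relation.Binary.PropositionalEquality
  open import Relation.Binary.Bundles using (Setoid)
  open import Level using (0ℓ)
  open import Relation.Nullary using (Dec; ¬_)
  open import Data.Empty using (⊥-elim)
  open import Data.Sum using (_⊎_; inj₁; inj₂)
  open import Data.Product using (_,_; Σ)

  infix 4 _∣ᵢ_ _∣ᵢ?_
  _∣ᵢ_ : ℕ → ℤ → Set
  m ∣ᵢ u = + m ∣ u

  _∣ᵢ?_ : ∀ m u → Dec (m ∣ᵢ u)
  m ∣ᵢ? u = + m ∣? u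

  ∣-subst : ∀ {m u v} → u ≡ v → m ∣ᵢ u → m ∣ᵢ v
  ∣-subst refl m∣u = m∣u

  ∣-+ : ∀ {m u v} → m ∣ᵢ u → m ∣ᵢ v → m ∣ᵢ u + v
  ∣-+ = ∣m∣n⇒∣m+n

  ∣-* : ∀ {m u} v → m ∣ᵢ u → m ∣ᵢ u * v
  ∣-* v = ∣m⇒∣m*n v

  ∣-*ˡ : ∀ {m u} v → m ∣ᵢ u → m ∣ᵢ v * u
  ∣-*ˡ v = ∣n⇒∣m*n v

  ∣-neg : ∀ {m u} → m ∣ᵢ u → m ∣ᵢ - u
  ∣-neg = ∣m⇒∣-m

  ∣-zero : ∀ m → m ∣ᵢ + 0
  ∣-zero m = divides (+ 0) refl

  ∣-%ℕ : ∀ u m .{{_ : NonZero m}} → m ∣ᵢ u - + (u %ℕ m)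
  ∣-%ℕ u m = divides (u /ℕ m) (trans (cong (_- + (u %ℕ m)) (a≡a%ℕn+[a/ℕn]*n u m)) (cancel (+ (u %ℕ m)) (u /ℕ m) (+ m)))
    where cancel : ∀ r q m → r + q * m - r ≡ q * m
          cancel = solve-∀

  %ℕ≡0⇒∣ : ∀ u m .{{_ : NonZero m}} → u %ℕ m ≡ 0 → m ∣ᵢ u
  %ℕ≡0⇒∣ u m r≡0 = divides (u /ℕ m)
    (trans (a≡a%ℕn+[a/ℕn]*n u m) (trans (cong (λ r → + r + (u /ℕ m) * + m) r≡0) (ℤₚ.+-identityˡ _)))

  ∣⇒%ℕ≡0 : ∀ u m .{{_ : NonZero m}} → m ∣ᵢ u → u %ℕ m ≡ 0
  ∣⇒%ℕ≡0 u m (divides q u≡qm) = r≡0 ∣ q - u /ℕ m ∣ refl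
    where
    r : ℕ
    r = u %ℕ m
    r≡[q-u/m]m : + r ≡ (q - u /ℕ m) * + m
    r≡[q-u/m]m = begin
      + r                         ≡⟨ shift (+ r) (u /ℕ m) (+ m) ⟩
      (+ r + u /ℕ m * + m) - u /ℕ m * + m ≡⟨ cong (_- u /ℕ m * + m) (sym (a≡a%ℕn+[a/ℕn]*n u m)) ⟩
      u - u /ℕ m * + m            ≡⟨ cong (_- u /ℕ m * + m) u≡qm ⟩
      q * + m - u /ℕ m * + m      ≡⟨ factor q (u /ℕ m) (+ m) ⟩
      (q - u /ℕ m) * + m          ∎
      where open ≡-Reasoning
            shift : ∀ r p m → r ≡ (r + p * m) - p * m
            shift = solve-∀
            factor : ∀ q p m → q * m - p * m ≡ (q - p) * m
            factor = solve-∀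
    r≡∣q-u/m∣*m : r ≡ ∣ q - u /ℕ m ∣ ℕ.* m
    r≡∣q-u/m∣*m = trans (cong ∣_∣ r≡[q-u/m]m) (ℤₚ.abs-* (q - u /ℕ m) (+ m))
    r≡0 : ∀ z → ∣ q - u /ℕ m ∣ ≡ z → r ≡ 0
    r≡0 zero    e = trans r≡∣q-u/m∣*m (cong (ℕ._* m) e)
    r≡0 (suc z) e = ⊥-elim (ℕₚ.<⇒≱ (n%ℕd<d u m)
      (subst (m ℕ.≤_) (sym (trans r≡∣q-u/m∣*m (cong (ℕ._* m) e))) (ℕₚ.m≤m+n m (z ℕ.* m))))

  ∣-<⇒≡ : ∀ m {t t′} → t ℕ.< m → t′ ℕ.< m → m ∣ᵢ + t - + t′ → t ≡ t′
  ∣-<⇒≡ m {t} {t′} t<m t′<m m∣t-t′ =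
    ℤₚ.+-injective (ℤₚ.i-j≡0⇒i≡j (+ t) (+ t′) (ℤₚ.∣i∣≡0⇒i≡0 ∣t-t′∣≡0))
    where
    ∣t⊖t′∣<m : ∣ t ⊖ t′ ∣ ℕ.< m
    ∣t⊖t′∣<m with ℕₚ.≤-total t t′
    ... | inj₁ t≤t′ = subst (ℕ._< m) (sym (ℤₚ.∣⊖∣-≤ t≤t′)) (ℕₚ.≤-<-trans (ℕₚ.m∸n≤m t′ t) t′<m)
    ... | inj₂ t′≤t = subst (ℕ._< m) (sym (trans (ℤₚ.∣m⊖n∣≡∣n⊖m∣ t t′) (ℤₚ.∣⊖∣-≤ t′≤t)))
                        (ℕₚ.≤-<-trans (ℕₚ.m∸n≤m t t′) t<m)
    ∣t-t′∣≡0 : ∣ + t - + t′ ∣ ≡ 0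
    ∣t-t′∣≡0 with ∣ + t - + t′ ∣ in e
    ... | zero  = refl
    ... | suc _ = ⊥-elim (ℕₚ.<⇒≱ (subst (ℕ._< m) (trans (sym (cong ∣_∣ (ℤₚ.m-n≡m⊖n t t′))) e) ∣t⊖t′∣<m)
                           (ℕ∣.∣⇒≤ (subst (m ℕ∣.∣_) e (∣⇒∣ᵤ m∣t-t′))))

  ∤-< : ∀ m {t t′} → t ℕ.< m → t′ ℕ.< m → t ≢ t′ → ¬ m ∣ᵢ + t - + t′
  ∤-< m t<m t′<m t≢t′ m∣t-t′ = t≢t′ (∣-<⇒≡ m t<m t′<m m∣t-t′)

  euclidsLemmaℤ : ∀ {p} → Prime p → ∀ u v → p ∣ᵢ u * v → p ∣ᵢ u ⊎ p ∣ᵢ v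
  euclidsLemmaℤ {p} p-prime u v p∣uv
    with euclidsLemma ∣ u ∣ ∣ v ∣ p-prime (subst (p ℕ∣.∣_) (ℤₚ.abs-* u v) (∣⇒∣ᵤ p∣uv))
  ... | inj₁ p∣u = inj₁ (∣ᵤ⇒∣ p∣u)
  ... | inj₂ p∣v = inj₂ (∣ᵤ⇒∣ p∣v)

  ∣*∤⇒∣ : ∀ {p} → Prime p → ∀ u v → p ∣ᵢ u * v → ¬ p ∣ᵢ u → p ∣ᵢ v
  ∣*∤⇒∣ p-prime u v p∣uv p∤u with euclidsLemmaℤ p-prime u v p∣uv
  ... | inj₁ p∣u = ⊥-elim (p∤u p∣u)
  ... | inj₂ p∣v = p∣v

  coprime⇒∤ : ∀ {p} → Prime p → ∀ k → Coprime ∣ k ∣ p → ¬ p ∣ᵢ k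
  coprime⇒∤ {p} p-prime k coprime p∣k with coprime (∣⇒∣ᵤ p∣k , ℕ∣.∣-refl)
  coprime⇒∤ {.1} p-prime k coprime p∣k | refl = ¬prime[1] p-prime

  inverse-mod-prime : ∀ {p} → Prime p → ∀ u → ¬ p ∣ᵢ u → Σ ℤ λ v → p ∣ᵢ u * v - + 1
  inverse-mod-prime {p} p-prime u p∤u = from-Bézout (coprime-Bézout (prime⇒coprime p-prime {{r≢0}} (n%ℕd<d u p)))
    where
    instance
      p≢0 : NonZero p
      p≢0 = prime⇒nonZero p-prime
    r : ℕ
    r = u %ℕ p
    r≢0 : NonZero r
    r≢0 with u %ℕ p in e
    ... | zero  = ⊥-elim (p∤u (%ℕ≡0⇒∣ u p e))
    ... | suc _ = _
    from-residue : ∀ v → p ∣ᵢ + r * v - + 1 → p ∣ᵢ u * v - + 1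
    from-residue v p∣rv-1 = ∣-subst (split u (+ r) v) (∣-+ (∣-* v (∣-%ℕ u p)) p∣rv-1)
      where split : ∀ u r v → (u - r) * v + (r * v - + 1) ≡ u * v - + 1
            split = solve-∀
    from-Bézout : GCD.Bézout.Identity 1 p r → Σ ℤ λ v → p ∣ᵢ u * v - + 1
    from-Bézout (GCD.Bézout.+- x y 1+yr≡xp) = - + y , from-residue (- + y) (divides (- + x) (begin
        + r * - + y - + 1    ≡⟨ rearrange (+ r) (+ y) ⟩
        - (+ 1 + + y * + r)  ≡⟨ cong -_ (trans (ℤₚ.pos-+ 1 (y ℕ.* r)) (cong (λ z → + 1 + z) (ℤₚ.pos-* y r))) ⟨
        - + (1 ℕ.+ y ℕ.* r)  ≡⟨ cong (λ z → - + z) 1+yr≡xp ⟩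
        - + (x ℕ.* p)        ≡⟨ cong -_ (ℤₚ.pos-* x p) ⟩
        - (+ x * + p)        ≡⟨ ℤₚ.neg-distribˡ-* (+ x) (+ p) ⟩
        - + x * + p          ∎))
      where open ≡-Reasoning
            rearrange : ∀ r y → r * - y - + 1 ≡ - (+ 1 + y * r)
            rearrange = solve-∀
    from-Bézout (GCD.Bézout.-+ x y 1+xp≡yr) = + y , from-residue (+ y) (divides (+ x) (begin
        + r * + y - + 1          ≡⟨ cong (_- + 1) (trans (cong +_ (ℕₚ.*-comm y r)) (ℤₚ.pos-* r y)) ⟨
        + (y ℕ.* r) - + 1        ≡⟨ cong (λ z → + z - + 1) (sym 1+xp≡yr) ⟩
        + (1 ℕ.+ x ℕ.* p) - + 1  ≡⟨ cong (_- + 1) (ℤₚ.pos-+ 1 (x ℕ.* p)) ⟩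
        + 1 + + (x ℕ.* p) - + 1  ≡⟨ cancel (+ (x ℕ.* p)) ⟩
        + (x ℕ.* p)              ≡⟨ ℤₚ.pos-* x p ⟩
        + x * + p                ∎))
      where open ≡-Reasoning
            cancel : ∀ a → + 1 + a - + 1 ≡ a
            cancel = solve-∀

  -- Newton iteration w ↦ w (2 - u w) squares the error u w - 1.
  inverse-mod-prime-power : ∀ {p} → Prime p → ∀ b u → ¬ p ∣ᵢ u → Σ ℤ λ w → (p ℕ.^ suc b) ∣ᵢ u * w - + 1
  inverse-mod-prime-power {p} p-prime zero u p∤u =
    let v , p∣uv-1 = inverse-mod-prime p-prime u p∤u in v , subst (_∣ᵢ u * v - + 1) (sym (ℕₚ.*-identityʳ p)) p∣uv-1
  inverse-mod-prime-power {p} p-prime (suc b) u p∤u with inverse-mod-prime-power p-prime b u p∤u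
  ... | w , divides t uw-1≡tL = w * (+ 1 - t * L) , divides (- (t * t) * + (p ℕ.^ b)) (begin
      u * (w * (+ 1 - t * L)) - + 1                             ≡⟨ regroup u w t L ⟩
      (u * w - + 1 + + 1) * (+ 1 - t * L) - + 1                 ≡⟨ cong (λ z → (z + + 1) * (+ 1 - t * L) - + 1) uw-1≡tL ⟩
      (t * L + + 1) * (+ 1 - t * L) - + 1                       ≡⟨ cong (λ z → (t * z + + 1) * (+ 1 - t * z) - + 1) L≡pq ⟩
      (t * (+ p * q) + + 1) * (+ 1 - t * (+ p * q)) - + 1       ≡⟨ square-error t (+ p) q ⟩
      - (t * t) * q * (+ p * (+ p * q))                         ≡⟨ cong (λ z → - (t * t) * q * (+ p * z)) L≡pq ⟨
      - (t * t) * q * (+ p * L)                                 ≡⟨ cong (- (t * t) * q *_) (ℤₚ.pos-* p (p ℕ.^ suc b)) ⟨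
      - (t * t) * q * + (p ℕ.^ suc (suc b))                     ∎)
    where
    open ≡-Reasoning
    L : ℤ
    L = + (p ℕ.^ suc b)
    q : ℤ
    q = + (p ℕ.^ b)
    L≡pq : L ≡ + p * q
    L≡pq = ℤₚ.pos-* p (p ℕ.^ b)
    regroup : ∀ u w t L → u * (w * (+ 1 - t * L)) - + 1 ≡ (u * w - + 1 + + 1) * (+ 1 - t * L) - + 1
    regroup = solve-∀
    square-error : ∀ t p q → (t * (p * q) + + 1) * (+ 1 - t * (p * q)) - + 1 ≡ - (t * t) * q * (p * (p * q))
    square-error = solve-∀

  module Congruence (m : ℕ) where

    infix 4 _≈_
    record _≈_ (u v : ℤ) : Set where
      constructor mod∣
      field ∣-difference : m ∣ᵢ u - v
    open _≈_ public

    ≈-refl : ∀ {u} → u ≈ u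
    ≈-refl {u} = mod∣ (∣-subst (sym (u-u≡0 u)) (∣-zero m))
      where u-u≡0 : ∀ u → u - u ≡ + 0
            u-u≡0 = solve-∀

    ≈-reflexive : ∀ {u v} → u ≡ v → u ≈ v
    ≈-reflexive refl = ≈-refl

    ≈-sym : ∀ {u v} → u ≈ v → v ≈ u
    ≈-sym {u} {v} (mod∣ m∣u-v) = mod∣ (∣-subst (negate u v) (∣-neg m∣u-v))
      where negate : ∀ u v → - (u - v) ≡ v - u
            negate = solve-∀

    ≈-trans : ∀ {u v w} → u ≈ v → v ≈ w → u ≈ w
    ≈-trans {u} {v} {w} (mod∣ m∣u-v) (mod∣ m∣v-w) = mod∣ (∣-subst (telescope u v w) (∣-+ m∣u-v m∣v-w))
      where telescope : ∀ u v w → (u - v) + (v - w) ≡ u - w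
            telescope = solve-∀

    +-cong : ∀ {u u′ v v′} → u ≈ u′ → v ≈ v′ → u + v ≈ u′ + v′
    +-cong {u} {u′} {v} {v′} (mod∣ d) (mod∣ e) = mod∣ (∣-subst (regroup u u′ v v′) (∣-+ d e))
      where regroup : ∀ u u′ v v′ → (u - u′) + (v - v′) ≡ (u + v) - (u′ + v′)
            regroup = solve-∀

    *-cong : ∀ {u u′ v v′} → u ≈ u′ → v ≈ v′ → u * v ≈ u′ * v′
    *-cong {u} {u′} {v} {v′} (mod∣ d) (mod∣ e) = mod∣ (∣-subst (regroup u u′ v v′) (∣-+ (∣-* v d) (∣-*ˡ u′ e)))
      where regroup : ∀ u u′ v v′ → (u - u′) * v + u′ * (v - v′) ≡ u * v - u′ * v′
            regroup = solve-∀

    neg-cong : ∀ {u u′} → u ≈ u′ → - u ≈ - u′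
    neg-cong {u} {u′} (mod∣ d) = mod∣ (∣-subst (regroup u u′) (∣-neg d))
      where regroup : ∀ u u′ → - (u - u′) ≡ - u - - u′
            regroup = solve-∀

    -‿cong : ∀ {u u′ v v′} → u ≈ u′ → v ≈ v′ → u - v ≈ u′ - v′
    -‿cong d e = +-cong d (neg-cong e)

    ∣⇒≈0 : ∀ {u} → m ∣ᵢ u → u ≈ + 0
    ∣⇒≈0 {u} m∣u = mod∣ (∣-subst (sym (u-0≡u u)) m∣u)
      where u-0≡u : ∀ u → u - + 0 ≡ u
            u-0≡u = solve-∀

    ≈0⇒∣ : ∀ {u} → u ≈ + 0 → m ∣ᵢ u
    ≈0⇒∣ {u} (mod∣ d) = ∣-subst (u-0≡u u) d
      where u-0≡u : ∀ u → u - + 0 ≡ u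
            u-0≡u = solve-∀

    ∣-resp-≈ : ∀ {u v} → u ≈ v → m ∣ᵢ u → m ∣ᵢ v
    ∣-resp-≈ u≈v m∣u = ≈0⇒∣ (≈-trans (≈-sym u≈v) (∣⇒≈0 m∣u))

    %ℕ≈ : ∀ u .{{_ : NonZero m}} → + (u %ℕ m) ≈ u
    %ℕ≈ u = ≈-sym (mod∣ (∣-%ℕ u m))

    ≈-setoid : Setoid 0ℓ 0ℓ
    ≈-setoid = record
      { Carrier = ℤ ; _≈_ = _≈_
      ; isEquivalence = record { refl = ≈-refl ; sym = ≈-sym ; trans = ≈-trans } }

module HenselLifting where

  open import Data.Integer using (ℤ; +_; _+_; _-_; _*_; -_; _%ℕ_)
  import Data.Integer.Properties as ℤₚ
  open import Data.Integer.Divisibility.Signed using (_∣_; divides; quotient; ∣-refl; ∣-trans; *-cancelˡ-∣; *-monoʳ-∣)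
  open import Data.Integer.DivMod using (n%ℕd<d)
  import Data.Nat as ℕ
  open ℕ using (ℕ; zero; suc; NonZero; _<_)
  import Data.Nat.Properties as ℕₚ
  open import Data.Nat.Primality using (Prime; prime⇒nonZero)
  open import Data.Integer.Tactic.RingSolver using (solve-∀)
  open import Relation.Binary.PropositionalEquality
  open import Relation.Nullary using (Dec; yes; no; ¬_)
  open import Relation.Nullary.Decidable using (_×-dec_; ¬?)
  open import Data.Product using (_×_; _,_; proj₁; proj₂)
  open FiniteSum
  open IntegerDivisibility

  norm : ℤ → ℤ → ℤ → ℤ → ℤ
  norm s c x y = x * (x + s * y) - c * y * y

  discriminant : ℤ → ℤ → ℤ
  discriminant s c = s * s + + 4 * c

  module _ (m : ℕ) where
    open Congruence m

    norm-cong : ∀ s c {x x′ y y′} → x ≈ x′ → y ≈ y′ → norm s c x y ≈ norm s c x′ y′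
    norm-cong s c x≈x′ y≈y′ =
      -‿cong (*-cong x≈x′ (+-cong x≈x′ (*-cong (≈-refl {s}) y≈y′))) (*-cong (*-cong (≈-refl {c}) y≈y′) y≈y′)

  module Solutions (s c k : ℤ) (ℓ : ℕ) (ℓ-prime : Prime ℓ)
                   (ℓ∤disc : ¬ ℓ ∣ᵢ discriminant s c) (ℓ∤k : ¬ ℓ ∣ᵢ k) where

    instance
      ℓ≢0 : NonZero ℓ
      ℓ≢0 = prime⇒nonZero ℓ-prime

    N : ℤ → ℤ → ℤ
    N = norm s c

    IsSolution : ℕ → ℤ → ℤ → Set
    IsSolution M x y = (M ∣ᵢ N x y - k) × ¬ (ℓ ∣ᵢ N (x - + 1) (y - + 0))

    isSolution? : ∀ M x y → Dec (IsSolution M x y)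
    isSolution? M x y = (M ∣ᵢ? N x y - k) ×-dec ¬? (ℓ ∣ᵢ? N (x - + 1) (y - + 0))

    solutions : ℕ → ℕ
    solutions M = ∑² M (λ x y → 𝟙 (isSolution? M (+ x) (+ y)))

    ∑-linear : ∀ e L → ¬ ℓ ∣ᵢ L → ∑ ℓ (λ t → 𝟙 (ℓ ∣ᵢ? e + L * + t)) ≡ 1
    ∑-linear e L ℓ∤L with inverse-mod-prime ℓ-prime L ℓ∤L
    ... | L⁻¹ , ℓ∣LL⁻¹-1 = ∑-𝟙-unique ℓ (λ t → ℓ ∣ᵢ? e + L * + t) t₀ (n%ℕd<d (- e * L⁻¹) ℓ) t₀-solves unique
      where
      open Congruence ℓ
      t₀ : ℕ
      t₀ = (- e * L⁻¹) %ℕ ℓ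
      t₀-solves : ℓ ∣ᵢ e + L * + t₀
      t₀-solves = ≈0⇒∣ (begin
        e + L * + t₀             ≈⟨ +-cong (≈-refl {e}) (*-cong (≈-refl {L}) (%ℕ≈ (- e * L⁻¹))) ⟩
        e + L * (- e * L⁻¹)      ≡⟨ rearrange e L L⁻¹ ⟩
        - e * (L * L⁻¹ - + 1)    ≈⟨ *-cong (≈-refl { - e}) (∣⇒≈0 ℓ∣LL⁻¹-1) ⟩
        - e * + 0                ≡⟨ ℤₚ.*-zeroʳ (- e) ⟩
        + 0                      ∎)
        where open import Relation.Binary.Reasoning.Setoid ≈-setoid
              rearrange : ∀ e L L⁻¹ → e + L * (- e * L⁻¹) ≡ - e * (L * L⁻¹ - + 1)
              rearrange = solve-∀
      unique : ∀ t → t < ℓ → ℓ ∣ᵢ e + L * + t → t ≡ t₀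
      unique t t<ℓ ℓ∣e+Lt = ∣-<⇒≡ ℓ t<ℓ (n%ℕd<d (- e * L⁻¹) ℓ) (∣*∤⇒∣ ℓ-prime L (+ t - + t₀) ℓ∣L[t-t₀] ℓ∤L)
        where
        difference : ∀ e L t t₀ → e + L * t + - (e + L * t₀) ≡ L * (t - t₀)
        difference = solve-∀
        ℓ∣L[t-t₀] : ℓ ∣ᵢ L * (+ t - + t₀)
        ℓ∣L[t-t₀] = ∣-subst (difference e L (+ t) (+ t₀)) (∣-+ ℓ∣e+Lt (∣-neg t₀-solves))

    ∑²-linear : ∀ e L₁ L₂ → ¬ (ℓ ∣ᵢ L₁ × ℓ ∣ᵢ L₂) →
                ∑² ℓ (λ t₁ t₂ → 𝟙 (ℓ ∣ᵢ? e + L₁ * + t₁ + L₂ * + t₂)) ≡ ℓ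
    ∑²-linear e L₁ L₂ ℓ∤L₁∧L₂ with ℓ ∣ᵢ? L₂
    ... | no ℓ∤L₂ = trans (∑-cong ℓ (λ t₁ _ → ∑-linear (e + L₁ * + t₁) L₂ ℓ∤L₂)) (trans (∑-const ℓ 1) (ℕₚ.*-identityʳ ℓ))
    ... | yes ℓ∣L₂ = trans (∑-swap ℓ ℓ _) (trans (∑-cong ℓ (λ t₂ _ →
            trans (∑-cong ℓ (λ t₁ _ → 𝟙-cong (ℓ ∣ᵢ? e + L₁ * + t₁ + L₂ * + t₂) (ℓ ∣ᵢ? e + L₂ * + t₂ + L₁ * + t₁)
                      (∣-subst (swap e L₁ L₂ (+ t₁) (+ t₂))) (∣-subst (sym (swap e L₁ L₂ (+ t₁) (+ t₂))))))
                  (∑-linear (e + L₂ * + t₂) L₁ (λ ℓ∣L₁ → ℓ∤L₁∧L₂ (ℓ∣L₁ , ℓ∣L₂)))))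
          (trans (∑-const ℓ 1) (ℕₚ.*-identityʳ ℓ)))
      where swap : ∀ e L₁ L₂ t₁ t₂ → e + L₁ * t₁ + L₂ * t₂ ≡ e + L₂ * t₂ + L₁ * t₁
            swap = solve-∀

    ∂₁N ∂₂N : ℤ → ℤ → ℤ
    ∂₁N x y = + 2 * x + s * y
    ∂₂N x y = s * x - + 2 * c * y

    -- A common prime factor of both partials divides disc · (x, y), hence x, y and N (x , y).
    ∇N≢0 : ∀ x y → ℓ ∣ᵢ N x y - k → ¬ (ℓ ∣ᵢ ∂₁N x y × ℓ ∣ᵢ ∂₂N x y)
    ∇N≢0 x y ℓ∣N-k (ℓ∣∂₁ , ℓ∣∂₂) = ℓ∤k (∣-subst (cancel (N x y) k) (∣-+ ℓ∣N (∣-neg ℓ∣N-k)))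
      where
      disc : ℤ
      disc = discriminant s c
      ℓ∣x : ℓ ∣ᵢ x
      ℓ∣x = ∣*∤⇒∣ ℓ-prime disc x (∣-subst (eliminate-y s c x y) (∣-+ (∣-*ˡ (+ 2 * c) ℓ∣∂₁) (∣-*ˡ s ℓ∣∂₂))) ℓ∤disc
        where eliminate-y : ∀ s c x y → + 2 * c * (+ 2 * x + s * y) + s * (s * x - + 2 * c * y) ≡ (s * s + + 4 * c) * x
              eliminate-y = solve-∀
      ℓ∣y : ℓ ∣ᵢ y
      ℓ∣y = ∣*∤⇒∣ ℓ-prime disc y (∣-subst (eliminate-x s c x y) (∣-+ (∣-*ˡ s ℓ∣∂₁) (∣-neg (∣-*ˡ (+ 2) ℓ∣∂₂)))) ℓ∤disc
        where eliminate-x : ∀ s c x y → s * (+ 2 * x + s * y) + - (+ 2 * (s * x - + 2 * c * y)) ≡ (s * s + + 4 * c) * y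
              eliminate-x = solve-∀
      ℓ∣N : ℓ ∣ᵢ N x y
      ℓ∣N = ∣-+ (∣-* (x + s * y) ℓ∣x) (∣-neg (∣-* y (∣-*ˡ c ℓ∣y)))
      cancel : ∀ n k → n + - (n - k) ≡ k
      cancel = solve-∀

    module Lift (m : ℕ) .{{_ : NonZero m}} (ℓ∣M : ℓ ∣ᵢ + m) where
      M : ℤ
      M = + m
      module ≈m = Congruence m
      module ≈ℓ = Congruence ℓ

      m∣ℓm : m ∣ᵢ + (ℓ ℕ.* m)
      m∣ℓm = divides (+ ℓ) (ℤₚ.pos-* ℓ m)

      ℓM≡M*ℓ : + (ℓ ℕ.* m) ≡ M * + ℓ
      ℓM≡M*ℓ = trans (cong +_ (ℕₚ.*-comm ℓ m)) (ℤₚ.pos-* m ℓ)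

      lifted≈ : ∀ R → R ∣ᵢ M → ∀ T x → Congruence._≈_ R (T * M + x) x
      lifted≈ R R∣M T x = Congruence.mod∣ (∣-subst (cancel T M x) (∣-*ˡ T R∣M))
        where cancel : ∀ T M x → T * M ≡ T * M + x - x
              cancel = solve-∀

      lifted-N≈ : ∀ T₁ T₂ x y → N (T₁ * M + x) (T₂ * M + y) ≈m.≈ N x y
      lifted-N≈ T₁ T₂ x y = norm-cong m s c (lifted≈ m ∣-refl T₁ x) (lifted≈ m ∣-refl T₂ y)

      lifted-N-1≈ : ∀ T₁ T₂ x y → N (T₁ * M + x - + 1) (T₂ * M + y - + 0) ≈ℓ.≈ N (x - + 1) (y - + 0)
      lifted-N-1≈ T₁ T₂ x y =
        norm-cong ℓ s c (≈ℓ.-‿cong (lifted≈ ℓ ℓ∣M T₁ x) (≈ℓ.≈-refl {+ 1})) (≈ℓ.-‿cong (lifted≈ ℓ ℓ∣M T₂ y) (≈ℓ.≈-refl {+ 0}))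

      lifted⇒solution : ∀ T₁ T₂ x y → IsSolution (ℓ ℕ.* m) (T₁ * M + x) (T₂ * M + y) → IsSolution m x y
      lifted⇒solution T₁ T₂ x y (ℓM∣N′-k , ℓ∤N′-1) =
          ≈m.∣-resp-≈ (≈m.-‿cong (lifted-N≈ T₁ T₂ x y) (≈m.≈-refl {k})) (∣-trans m∣ℓm ℓM∣N′-k)
        , λ ℓ∣N-1 → ℓ∤N′-1 (≈ℓ.∣-resp-≈ (≈ℓ.≈-sym (lifted-N-1≈ T₁ T₂ x y)) ℓ∣N-1)

      module _ (x y : ℤ) (sol : IsSolution m x y) where
        W : ℤ → ℤ → ℤ
        W T₁ T₂ = quotient (proj₁ sol) + ∂₁N x y * T₁ + ∂₂N x y * T₂

        -- Taylor expansion of N at (x , y): the quadratic term carries a factor M².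
        taylor : ∀ T₁ T₂ → N (T₁ * M + x) (T₂ * M + y) - k ≡ M * (W T₁ T₂ + M * N T₁ T₂)
        taylor T₁ T₂ = begin
          N (T₁ * M + x) (T₂ * M + y) - k
            ≡⟨ expand s c x y T₁ T₂ M k ⟩
          (N x y - k) + M * (∂₁N x y * T₁ + ∂₂N x y * T₂ + M * N T₁ T₂)
            ≡⟨ cong (_+ M * (∂₁N x y * T₁ + ∂₂N x y * T₂ + M * N T₁ T₂)) (_∣_.equality (proj₁ sol)) ⟩
          quotient (proj₁ sol) * M + M * (∂₁N x y * T₁ + ∂₂N x y * T₂ + M * N T₁ T₂)
            ≡⟨ factor (quotient (proj₁ sol)) M (∂₁N x y * T₁) (∂₂N x y * T₂) (N T₁ T₂) ⟩
          M * (W T₁ T₂ + M * N T₁ T₂)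
            ∎
          where
          open ≡-Reasoning
          expand : ∀ s c x y T₁ T₂ M k →
            (T₁ * M + x) * ((T₁ * M + x) + s * (T₂ * M + y)) - c * (T₂ * M + y) * (T₂ * M + y) - k
            ≡ (x * (x + s * y) - c * y * y - k) + M * ((+ 2 * x + s * y) * T₁ + (s * x - + 2 * c * y) * T₂
                + M * (T₁ * (T₁ + s * T₂) - c * T₂ * T₂))
          expand = solve-∀
          factor : ∀ e M a b n → e * M + M * (a + b + M * n) ≡ M * (e + a + b + M * n)
          factor = solve-∀

        ℓ∣Z⇔ℓ∣W : ∀ T₁ T₂ → (ℓ ∣ᵢ W T₁ T₂ + M * N T₁ T₂ → ℓ ∣ᵢ W T₁ T₂) × (ℓ ∣ᵢ W T₁ T₂ → ℓ ∣ᵢ W T₁ T₂ + M * N T₁ T₂)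
        ℓ∣Z⇔ℓ∣W T₁ T₂ =
            (λ ℓ∣Z → ∣-subst (cancel (W T₁ T₂) M (N T₁ T₂)) (∣-+ ℓ∣Z (∣-neg (∣-* (N T₁ T₂) ℓ∣M))))
          , (λ ℓ∣W → ∣-+ ℓ∣W (∣-* (N T₁ T₂) ℓ∣M))
          where cancel : ∀ w M n → w + M * n + - (M * n) ≡ w
                cancel = solve-∀

        lifted⇒ℓ∣W : ∀ T₁ T₂ → IsSolution (ℓ ℕ.* m) (T₁ * M + x) (T₂ * M + y) → ℓ ∣ᵢ W T₁ T₂
        lifted⇒ℓ∣W T₁ T₂ (ℓM∣N′-k , _) =
          proj₁ (ℓ∣Z⇔ℓ∣W T₁ T₂) (*-cancelˡ-∣ M (subst₂ _∣_ ℓM≡M*ℓ (taylor T₁ T₂) ℓM∣N′-k))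

        ℓ∣W⇒lifted : ∀ T₁ T₂ → ℓ ∣ᵢ W T₁ T₂ → IsSolution (ℓ ℕ.* m) (T₁ * M + x) (T₂ * M + y)
        ℓ∣W⇒lifted T₁ T₂ ℓ∣W =
            subst₂ _∣_ (sym ℓM≡M*ℓ) (sym (taylor T₁ T₂)) (*-monoʳ-∣ M (proj₂ (ℓ∣Z⇔ℓ∣W T₁ T₂) ℓ∣W))
          , λ ℓ∣N′-1 → proj₂ sol (≈ℓ.∣-resp-≈ (lifted-N-1≈ T₁ T₂ x y) ℓ∣N′-1)

      lifts : ∀ x y → ∑² ℓ (λ t₁ t₂ → 𝟙 (isSolution? (ℓ ℕ.* m) (+ (t₁ ℕ.* m ℕ.+ x)) (+ (t₂ ℕ.* m ℕ.+ y))))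
                       ≡ ℓ ℕ.* 𝟙 (isSolution? m (+ x) (+ y))
      lifts x y = trans (∑-cong ℓ (λ t₁ _ → ∑-cong ℓ (λ t₂ _ →
                          cong₂ (λ u v → 𝟙 (isSolution? (ℓ ℕ.* m) u v)) (pos-lift t₁ x) (pos-lift t₂ y))))
                        (count (isSolution? m (+ x) (+ y)))
        where
        pos-lift : ∀ t x → + (t ℕ.* m ℕ.+ x) ≡ + t * M + + x
        pos-lift t x = trans (ℤₚ.pos-+ (t ℕ.* m) x) (cong (_+ + x) (ℤₚ.pos-* t m))
        count : (sol? : Dec (IsSolution m (+ x) (+ y))) →
                ∑² ℓ (λ t₁ t₂ → 𝟙 (isSolution? (ℓ ℕ.* m) (+ t₁ * M + + x) (+ t₂ * M + + y))) ≡ ℓ ℕ.* 𝟙 sol?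
        count (yes sol) =
          trans (∑-cong ℓ (λ t₁ _ → ∑-cong ℓ (λ t₂ _ →
                   𝟙-cong (isSolution? (ℓ ℕ.* m) (+ t₁ * M + + x) (+ t₂ * M + + y)) (ℓ ∣ᵢ? W (+ x) (+ y) sol (+ t₁) (+ t₂))
                     (lifted⇒ℓ∣W (+ x) (+ y) sol (+ t₁) (+ t₂)) (ℓ∣W⇒lifted (+ x) (+ y) sol (+ t₁) (+ t₂)))))
            (trans (∑²-linear (quotient (proj₁ sol)) (∂₁N (+ x) (+ y)) (∂₂N (+ x) (+ y))
                      (∇N≢0 (+ x) (+ y) (∣-trans ℓ∣M (proj₁ sol))))
                   (sym (ℕₚ.*-identityʳ ℓ)))
        count (no ¬sol) =
          trans (∑-zero ℓ _ (λ t₁ _ → ∑-zero ℓ _ (λ t₂ _ →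
                   𝟙-no (isSolution? (ℓ ℕ.* m) (+ t₁ * M + + x) (+ t₂ * M + + y)) (λ lifted → ¬sol (lifted⇒solution (+ t₁) (+ t₂) (+ x) (+ y) lifted)))))
            (sym (ℕₚ.*-zeroʳ ℓ))

      solutions-lift : solutions (ℓ ℕ.* m) ≡ ℓ ℕ.* solutions m
      solutions-lift = begin
        ∑ (ℓ ℕ.* m) (λ X → ∑ (ℓ ℕ.* m) (λ Y → g X Y))
          ≡⟨ ∑-blocks ℓ m _ ⟩
        ∑ ℓ (λ t₁ → ∑ m (λ x → ∑ (ℓ ℕ.* m) (λ Y → g (t₁ ℕ.* m ℕ.+ x) Y)))
          ≡⟨ ∑-cong ℓ (λ t₁ _ → ∑-cong m (λ x _ → ∑-blocks ℓ m _)) ⟩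
        ∑ ℓ (λ t₁ → ∑ m (λ x → ∑ ℓ (λ t₂ → ∑ m (λ y → g (t₁ ℕ.* m ℕ.+ x) (t₂ ℕ.* m ℕ.+ y)))))
          ≡⟨ ∑-swap ℓ m _ ⟩
        ∑ m (λ x → ∑ ℓ (λ t₁ → ∑ ℓ (λ t₂ → ∑ m (λ y → g (t₁ ℕ.* m ℕ.+ x) (t₂ ℕ.* m ℕ.+ y)))))
          ≡⟨ ∑-cong m (λ x _ → ∑-cong ℓ (λ t₁ _ → ∑-swap ℓ m _)) ⟩
        ∑ m (λ x → ∑ ℓ (λ t₁ → ∑ m (λ y → ∑ ℓ (λ t₂ → g (t₁ ℕ.* m ℕ.+ x) (t₂ ℕ.* m ℕ.+ y)))))
          ≡⟨ ∑-cong m (λ x _ → ∑-swap ℓ m _) ⟩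
        ∑ m (λ x → ∑ m (λ y → ∑ ℓ (λ t₁ → ∑ ℓ (λ t₂ → g (t₁ ℕ.* m ℕ.+ x) (t₂ ℕ.* m ℕ.+ y)))))
          ≡⟨ ∑-cong m (λ x _ → ∑-cong m (λ y _ → lifts x y)) ⟩
        ∑ m (λ x → ∑ m (λ y → ℓ ℕ.* 𝟙 (isSolution? m (+ x) (+ y))))
          ≡⟨ ∑-cong m (λ x _ → ∑-*ˡ m ℓ _) ⟩
        ∑ m (λ x → ℓ ℕ.* ∑ m (λ y → 𝟙 (isSolution? m (+ x) (+ y))))
          ≡⟨ ∑-*ˡ m ℓ _ ⟩
        ℓ ℕ.* solutions m
          ∎
        where
        open ≡-Reasoning
        g : ℕ → ℕ → ℕ
        g X Y = 𝟙 (isSolution? (ℓ ℕ.* m) (+ X) (+ Y))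

    solutions-prime-power : ∀ b → solutions (ℓ ℕ.^ suc b) ≡ ℓ ℕ.^ b ℕ.* solutions ℓ
    solutions-prime-power zero    = trans (cong solutions (ℕₚ.*-identityʳ ℓ)) (sym (ℕₚ.*-identityˡ _))
    solutions-prime-power (suc b) = trans (Lift.solutions-lift (ℓ ℕ.^ suc b) {{ℕₚ.m^n≢0 ℓ (suc b)}} ℓ∣ℓ^[1+b])
      (trans (cong (ℓ ℕ.*_) (solutions-prime-power b)) (sym (ℕₚ.*-assoc ℓ (ℓ ℕ.^ b) _)))
      where
      ℓ∣ℓ^[1+b] : ℓ ∣ᵢ + (ℓ ℕ.^ suc b)
      ℓ∣ℓ^[1+b] = divides (+ (ℓ ℕ.^ b)) (trans (ℤₚ.pos-* ℓ (ℓ ℕ.^ b)) (ℤₚ.*-comm (+ ℓ) _))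

module Enumeration where

  open import Data.Nat using (ℕ; zero; suc; _+_)
  open import Data.Fin using (Fin; toℕ)
  import Data.Fin as Fin
  open import Data.List using (List; []; _∷_; _++_; map; filter; length; tabulate; allFin; cartesianProduct)
  open import Data.List.Properties using (map-++; map-∘)
  open import Data.Nat.ListAction using (sum)
  open import Data.Nat.ListAction.Properties using (sum-++)
  open import Data.Product using (_,_; _×_)
  open import Relation.Binary.PropositionalEquality
  open import Relation.Nullary using (yes; no)
  open import Relation.Unary using (Decidable)
  open FiniteSum

  length-filter : ∀ {A : Set} {P : A → Set} (P? : Decidable P) xs →
                  length (filter P? xs) ≡ sum (map (λ x → 𝟙 (P? x)) xs)
  length-filter P? [] = refl
  length-filter P? (x ∷ xs) with P? x
  ... | yes _ = cong suc (length-filter P? xs)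
  ... | no _  = length-filter P? xs

  sum-cartesianProduct : ∀ {A B : Set} (xs : List A) (ys : List B) (f : A × B → ℕ) →
    sum (map f (cartesianProduct xs ys)) ≡ sum (map (λ x → sum (map (λ y → f (x , y)) ys)) xs)
  sum-cartesianProduct []       ys f = refl
  sum-cartesianProduct (x ∷ xs) ys f = begin
    sum (map f (map (x ,_) ys ++ cartesianProduct xs ys))
      ≡⟨ cong sum (map-++ f (map (x ,_) ys) _) ⟩
    sum (map f (map (x ,_) ys) ++ map f (cartesianProduct xs ys))
      ≡⟨ sum-++ (map f (map (x ,_) ys)) _ ⟩
    sum (map f (map (x ,_) ys)) + sum (map f (cartesianProduct xs ys))
      ≡⟨ cong₂ _+_ (cong sum (sym (map-∘ ys))) (sum-cartesianProduct xs ys f) ⟩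
    sum (map (λ y → f (x , y)) ys) + sum (map (λ x → sum (map (λ y → f (x , y)) ys)) xs)
      ∎
    where open ≡-Reasoning

  sum-tabulate : ∀ n {m} (h : Fin n → Fin m) (f : Fin m → ℕ) (g : ℕ → ℕ) →
                 (∀ i → f (h i) ≡ g (toℕ i)) → sum (map f (tabulate h)) ≡ ∑ n g
  sum-tabulate zero    h f g f∘h≡g = refl
  sum-tabulate (suc n) h f g f∘h≡g =
    cong₂ _+_ (f∘h≡g Fin.zero) (sum-tabulate n (λ i → h (Fin.suc i)) f (λ i → g (suc i)) (λ i → f∘h≡g (Fin.suc i)))

  sum-allFin : ∀ n (f : Fin n → ℕ) (g : ℕ → ℕ) → (∀ i → f i ≡ g (toℕ i)) → sum (map f (allFin n)) ≡ ∑ n g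
  sum-allFin n = sum-tabulate n (λ i → i)

module ResidueCount where

  open import Defs
  open import Data.Integer using (ℤ; +_; _+_; _-_; _*_; -_)
  open import Data.Integer.DivMod using (n%ℕd<d)
  open import Data.Nat using (ℕ; suc; NonZero; _^_)
  import Data.Nat.Properties as ℕₚ
  open import Data.Nat.Primality using (Prime)
  open import Data.Fin using (Fin; toℕ; fromℕ<)
  import Data.Fin.Properties as Finₚ
  open import Data.Integer.Tactic.RingSolver using (solve-∀)
  open import Relation.Binary.PropositionalEquality
  open import Relation.Nullary using (¬_)
  open import Data.Product using (_,_; proj₁; proj₂)
  open import Data.List using (length; filter; map; allFin; cartesianProduct)
  open import Data.Nat.ListAction using (sum)
  import Data.Integer.Properties as ℤₚ
  open FiniteSum
  open IntegerDivisibility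
  open HenselLifting
  open Enumeration

  module _ (d k : ℤ) (ℓ : ℕ) (ℓ-prime : Prime ℓ)
           (ℓ∤disc : ¬ ℓ ∣ᵢ discriminant (ωs d) (ωc d)) (ℓ∤k : ¬ ℓ ∣ᵢ k) (b : ℕ) where
    open Solutions (ωs d) (ωc d) k ℓ ℓ-prime ℓ∤disc ℓ∤k
    open Congruence (ℓ ^ suc b)
    private
      s : ℤ
      s = ωs d
      c : ℤ
      c = ωc d
      M : ℕ
      M = ℓ ^ suc b
      instance
        M≢0 : NonZero M
        M≢0 = ℕₚ.m^n≢0 ℓ (suc b)

      k⁻¹ : ℤ
      k⁻¹ = proj₁ (inverse-mod-prime-power ℓ-prime b k ℓ∤k)

      kk⁻¹≈1 : k * k⁻¹ ≈ + 1
      kk⁻¹≈1 = mod∣ (proj₂ (inverse-mod-prime-power ℓ-prime b k ℓ∤k))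

      residue≈ : ∀ u → + toℕ (fromℕ< (n%ℕd<d u M)) ≈ u
      residue≈ u = ≈-trans (≈-reflexive (cong +_ (Finₚ.toℕ-fromℕ< (n%ℕd<d u M)))) (%ℕ≈ u)

    -- The inverse of a residue of norm k is k⁻¹ times its conjugate (x + s y) - y ω.
    norm-unit⇒unit : ∀ (g : Res M) → M ∣ᵢ N (proj₁ (toOK g)) (proj₂ (toOK g)) - k → IsUnit d M g
    norm-unit⇒unit (i , j) M∣N-k =
      fromℕ< (n%ℕd<d ((X + s * Y) * k⁻¹) M) , fromℕ< (n%ℕd<d (- Y * k⁻¹) M) ,
      ∣⇒%ℕ≡0 _ M (∣-difference first≈1) , ∣⇒%ℕ≡0 _ M (∣-difference second≈0)
      where
      open import Relation.Binary.Reasoning.Setoid ≈-setoid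
      X : ℤ
      X = + toℕ i
      Y : ℤ
      Y = + toℕ j
      h₁ : ℤ
      h₁ = (X + s * Y) * k⁻¹
      h₂ : ℤ
      h₂ = - Y * k⁻¹
      H₁ : ℤ
      H₁ = + toℕ (fromℕ< (n%ℕd<d h₁ M))
      H₂ : ℤ
      H₂ = + toℕ (fromℕ< (n%ℕd<d h₂ M))
      first≈1 : X * H₁ + c * Y * H₂ ≈ + 1
      first≈1 = begin
        X * H₁ + c * Y * H₂
          ≈⟨ +-cong (*-cong (≈-refl {X}) (residue≈ h₁)) (*-cong (≈-refl {c * Y}) (residue≈ h₂)) ⟩
        X * ((X + s * Y) * k⁻¹) + c * Y * (- Y * k⁻¹)  ≡⟨ conjugate₁ s c X Y k⁻¹ ⟩
        N X Y * k⁻¹                                      ≈⟨ *-cong (mod∣ {N X Y} {k} M∣N-k) (≈-refl {k⁻¹}) ⟩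
        k * k⁻¹                                          ≈⟨ kk⁻¹≈1 ⟩
        + 1                                              ∎
        where conjugate₁ : ∀ s c X Y w → X * ((X + s * Y) * w) + c * Y * (- Y * w) ≡ (X * (X + s * Y) - c * Y * Y) * w
              conjugate₁ = solve-∀
      second≈0 : X * H₂ + H₁ * Y + s * Y * H₂ ≈ + 0
      second≈0 = begin
        X * H₂ + H₁ * Y + s * Y * H₂
          ≈⟨ +-cong (+-cong (*-cong (≈-refl {X}) (residue≈ h₂)) (*-cong (residue≈ h₁) (≈-refl {Y})))
                    (*-cong (≈-refl {s * Y}) (residue≈ h₂)) ⟩
        X * (- Y * k⁻¹) + (X + s * Y) * k⁻¹ * Y + s * Y * (- Y * k⁻¹)  ≡⟨ conjugate₂ s X Y k⁻¹ ⟩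
        + 0                                                             ∎
        where conjugate₂ : ∀ s X Y w → X * (- Y * w) + (X + s * Y) * w * Y + s * Y * (- Y * w) ≡ + 0
              conjugate₂ = solve-∀

    private
      N-1 : Fin M → Fin M → ℤ
      N-1 i j = N (+ toℕ i - + 1) (+ toℕ j - + 0)

    Cond⇒IsSolution : ∀ g → Cond d ℓ (suc b) k g → IsSolution M (+ toℕ (proj₁ g)) (+ toℕ (proj₂ g))
    Cond⇒IsSolution (i , j) (_ , ℓ∤N-1 , N≡k) =
      %ℕ≡0⇒∣ _ M N≡k , λ ℓ∣N-1 → ℓ∤N-1 (∣⇒%ℕ≡0 _ ℓ (∣-subst (sym (ℤₚ.+-identityʳ (N-1 i j))) ℓ∣N-1))

    IsSolution⇒Cond : ∀ g → IsSolution M (+ toℕ (proj₁ g)) (+ toℕ (proj₂ g)) → Cond d ℓ (suc b) k g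
    IsSolution⇒Cond (i , j) (M∣N-k , ℓ∤N-1) =
        norm-unit⇒unit (i , j) M∣N-k
      , (λ N-1≡0 → ℓ∤N-1 (∣-subst (ℤₚ.+-identityʳ (N-1 i j)) (%ℕ≡0⇒∣ _ ℓ N-1≡0)))
      , ∣⇒%ℕ≡0 _ M M∣N-k

    countN≡solutions : countN d ℓ (suc b) k ≡ solutions M
    countN≡solutions = begin
      length (filter (cond? d ℓ (suc b) k) (cartesianProduct (allFin M) (allFin M)))
        ≡⟨ length-filter (cond? d ℓ (suc b) k) (cartesianProduct (allFin M) (allFin M)) ⟩
      sum (map (λ g → 𝟙 (cond? d ℓ (suc b) k g)) (cartesianProduct (allFin M) (allFin M)))
        ≡⟨ sum-cartesianProduct (allFin M) (allFin M) _ ⟩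
      sum (map (λ i → sum (map (λ j → 𝟙 (cond? d ℓ (suc b) k (i , j))) (allFin M))) (allFin M))
        ≡⟨ sum-allFin M _ _ (λ i → sum-allFin M _ _ (λ j →
             𝟙-cong (cond? d ℓ (suc b) k (i , j)) (isSolution? M (+ toℕ i) (+ toℕ j)) (Cond⇒IsSolution (i , j)) (IsSolution⇒Cond (i , j)))) ⟩
      solutions M
        ∎
      where open ≡-Reasoning

module ChangeOfVariables where

  open import Data.Integer using (ℤ; +_; _+_; _-_; _*_; -_; _%ℕ_)
  open import Data.Nat using (ℕ; NonZero; _<_)
  open import Data.Nat.Primality using (Prime)
  open import Relation.Nullary using (¬_)
  open IntegerDivisibility using (_∣ᵢ_)

  module Linear (ℓ : ℕ) (ℓ-prime : Prime ℓ) (a₁₁ a₁₂ a₂₁ a₂₂ : ℤ)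
                (ℓ∤det : ¬ ℓ ∣ᵢ a₁₁ * a₂₂ - a₁₂ * a₂₁) where

    open import Data.Integer.DivMod using (n%ℕd<d)
    open import Data.Integer.Tactic.RingSolver using (solve-∀)
    import Data.Integer.Properties as ℤₚ
    open import Data.Nat.Primality using (prime⇒nonZero)
    open import Relation.Binary.PropositionalEquality using (_≡_)
    open import Data.Product using (_×_; _,_; proj₁; proj₂)
    open FiniteSum using (∑²; ∑²-reindex)
    open IntegerDivisibility
    open Congruence ℓ

    private
      instance
        ℓ≢0 : NonZero ℓ
        ℓ≢0 = prime⇒nonZero ℓ-prime

      det : ℤ
      det = a₁₁ * a₂₂ - a₁₂ * a₂₁
      det⁻¹ : ℤ
      det⁻¹ = proj₁ (inverse-mod-prime ℓ-prime det ℓ∤det)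

      cancel-det : ∀ z → det⁻¹ * (det * z) ≈ z
      cancel-det z = ≈-trans (≈-reflexive (reassociate det⁻¹ det z))
        (≈-trans (*-cong (mod∣ {det * det⁻¹} {+ 1} (proj₂ (inverse-mod-prime ℓ-prime det ℓ∤det))) (≈-refl {z})) (≈-reflexive (ℤₚ.*-identityˡ z)))
        where reassociate : ∀ w d z → w * (d * z) ≡ d * w * z
              reassociate = solve-∀

      substitute : ℤ → ℤ → ℤ → ℕ → ℕ → ℕ
      substitute w α β x y = (w * (α * + x + β * + y)) %ℕ ℓ

    φ₁ φ₂ ψ₁ ψ₂ : ℕ → ℕ → ℕ
    φ₁ = substitute (+ 1) a₁₁ a₁₂
    φ₂ = substitute (+ 1) a₂₁ a₂₂
    ψ₁ = substitute det⁻¹ a₂₂ (- a₁₂)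
    ψ₂ = substitute det⁻¹ (- a₂₁) a₁₁

    substitute≈ : ∀ w α β x y → + substitute w α β x y ≈ w * (α * + x + β * + y)
    substitute≈ w α β x y = %ℕ≈ (w * (α * + x + β * + y))

    private
      substitute² : ∀ w α β w₁ α₁ β₁ w₂ α₂ β₂ x y →
        + substitute w α β (substitute w₁ α₁ β₁ x y) (substitute w₂ α₂ β₂ x y)
        ≈ w * (α * (w₁ * (α₁ * + x + β₁ * + y)) + β * (w₂ * (α₂ * + x + β₂ * + y)))
      substitute² w α β w₁ α₁ β₁ w₂ α₂ β₂ x y = ≈-trans (substitute≈ w α β _ _)
        (*-cong (≈-refl {w}) (+-cong (*-cong (≈-refl {α}) (substitute≈ w₁ α₁ β₁ x y)) (*-cong (≈-refl {β}) (substitute≈ w₂ α₂ β₂ x y))))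

      residue-≡ : ∀ {t z n} → t < ℓ → z < ℓ → + t ≈ n → n ≡ det⁻¹ * (det * + z) → t ≡ z
      residue-≡ {z = z} t<ℓ z<ℓ t≈n n≡ = ∣-<⇒≡ ℓ t<ℓ z<ℓ (∣-difference (≈-trans t≈n (≈-trans (≈-reflexive n≡) (cancel-det (+ z)))))

      substitute< : ∀ w α β x y → substitute w α β x y < ℓ
      substitute< w α β x y = n%ℕd<d (w * (α * + x + β * + y)) ℓ

      ψ∘φ : ∀ x y → x < ℓ → y < ℓ → ψ₁ (φ₁ x y) (φ₂ x y) ≡ x × ψ₂ (φ₁ x y) (φ₂ x y) ≡ y
      ψ∘φ x y x<ℓ y<ℓ =
          residue-≡ (substitute< det⁻¹ a₂₂ (- a₁₂) (φ₁ x y) (φ₂ x y)) x<ℓ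
            (substitute² det⁻¹ a₂₂ (- a₁₂) (+ 1) a₁₁ a₁₂ (+ 1) a₂₁ a₂₂ x y) (ψ₁∘φ det⁻¹ a₁₁ a₁₂ a₂₁ a₂₂ (+ x) (+ y))
        , residue-≡ (substitute< det⁻¹ (- a₂₁) a₁₁ (φ₁ x y) (φ₂ x y)) y<ℓ
            (substitute² det⁻¹ (- a₂₁) a₁₁ (+ 1) a₁₁ a₁₂ (+ 1) a₂₁ a₂₂ x y) (ψ₂∘φ det⁻¹ a₁₁ a₁₂ a₂₁ a₂₂ (+ x) (+ y))
        where
        ψ₁∘φ : ∀ w a b c d x y → w * (d * (+ 1 * (a * x + b * y)) + - b * (+ 1 * (c * x + d * y))) ≡ w * ((a * d - b * c) * x)
        ψ₁∘φ = solve-∀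
        ψ₂∘φ : ∀ w a b c d x y → w * (- c * (+ 1 * (a * x + b * y)) + a * (+ 1 * (c * x + d * y))) ≡ w * ((a * d - b * c) * y)
        ψ₂∘φ = solve-∀

      φ∘ψ : ∀ u v → u < ℓ → v < ℓ → φ₁ (ψ₁ u v) (ψ₂ u v) ≡ u × φ₂ (ψ₁ u v) (ψ₂ u v) ≡ v
      φ∘ψ u v u<ℓ v<ℓ =
          residue-≡ (substitute< (+ 1) a₁₁ a₁₂ (ψ₁ u v) (ψ₂ u v)) u<ℓ
            (substitute² (+ 1) a₁₁ a₁₂ det⁻¹ a₂₂ (- a₁₂) det⁻¹ (- a₂₁) a₁₁ u v) (φ₁∘ψ det⁻¹ a₁₁ a₁₂ a₂₁ a₂₂ (+ u) (+ v))
        , residue-≡ (substitute< (+ 1) a₂₁ a₂₂ (ψ₁ u v) (ψ₂ u v)) v<ℓ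
            (substitute² (+ 1) a₂₁ a₂₂ det⁻¹ a₂₂ (- a₁₂) det⁻¹ (- a₂₁) a₁₁ u v) (φ₂∘ψ det⁻¹ a₁₁ a₁₂ a₂₁ a₂₂ (+ u) (+ v))
        where
        φ₁∘ψ : ∀ w a b c d u v → + 1 * (a * (w * (d * u + - b * v)) + b * (w * (- c * u + a * v))) ≡ w * ((a * d - b * c) * u)
        φ₁∘ψ = solve-∀
        φ₂∘ψ : ∀ w a b c d u v → + 1 * (c * (w * (d * u + - b * v)) + d * (w * (- c * u + a * v))) ≡ w * ((a * d - b * c) * v)
        φ₂∘ψ = solve-∀

    ∑²-substitute : ∀ F → ∑² ℓ (λ x y → F (φ₁ x y) (φ₂ x y)) ≡ ∑² ℓ F
    ∑²-substitute F = ∑²-reindex ℓ φ₁ φ₂ ψ₁ ψ₂ F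
      (λ x y _ _ → substitute< (+ 1) a₁₁ a₁₂ x y , substitute< (+ 1) a₂₁ a₂₂ x y)
      (λ u v _ _ → substitute< det⁻¹ a₂₂ (- a₁₂) u v , substitute< det⁻¹ (- a₂₁) a₁₁ u v) ψ∘φ φ∘ψ

module SplitCount where

  open import Data.Integer using (ℤ; +_; _+_; _-_; _*_; -_; _%ℕ_)
  open import Data.Integer.DivMod using (n%ℕd<d)
  import Data.Nat as ℕ
  open ℕ using (ℕ; suc; _≤_; _<_; _∸_; z≤n; s≤s)
  import Data.Nat.Properties as ℕₚ
  open import Data.Nat.Primality using (Prime; prime⇒nonTrivial)
  open import Data.Integer.Tactic.RingSolver using (solve-∀)
  open import Relation.Binary.PropositionalEquality
  open import Relation.Nullary using (Dec; yes; no; ¬_)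
  open import Relation.Nullary.Decidable using (_×-dec_; ¬?)
  import Data.Integer.Properties as ℤₚ
  open import Data.Empty using (⊥-elim)
  open import Data.Product using (_×_; _,_)
  open FiniteSum
  open IntegerDivisibility
  open HenselLifting using (discriminant; module Solutions)

  module _ (s c k : ℤ) (ℓ : ℕ) (ℓ-prime : Prime ℓ)
           (ℓ∤disc : ¬ ℓ ∣ᵢ discriminant s c) (ℓ∤k : ¬ ℓ ∣ᵢ k)
           (r : ℤ) (r-root : ℓ ∣ᵢ r * r - s * r - c) where

    open Solutions s c k ℓ ℓ-prime ℓ∤disc ℓ∤k
    open Congruence ℓ

    private
      r′ : ℤ
      r′ = s - r

      ℓ∤r′-r : ¬ ℓ ∣ᵢ + 1 * r′ - r * + 1
      ℓ∤r′-r ℓ∣r′-r = ℓ∤disc (∣-subst (root-difference² s c r) (∣-+ (∣-* (+ 1 * r′ - r * + 1) ℓ∣r′-r) (∣-neg (∣-*ˡ (+ 4) r-root))))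
        where root-difference² : ∀ s c r → (+ 1 * (s - r) - r * + 1) * (+ 1 * (s - r) - r * + 1) + - (+ 4 * (r * r - s * r - c)) ≡ s * s + + 4 * c
              root-difference² = solve-∀

    open ChangeOfVariables.Linear ℓ ℓ-prime (+ 1) r (+ 1) r′ ℓ∤r′-r

    norm≈product : ∀ x y → N x y ≈ (x + r * y) * (x + r′ * y)
    norm≈product x y = ≈-sym (≈-trans (≈-reflexive (factor s c r x y))
      (≈-trans (-‿cong (≈-refl {N x y}) (∣⇒≈0 (∣-*ˡ (y * y) r-root))) (≈-reflexive (ℤₚ.+-identityʳ (N x y)))))
      where factor : ∀ s c r x y → (x + r * y) * (x + (s - r) * y) ≡ (x * (x + s * y) - c * y * y) - y * y * (r * r - s * r - c)
            factor = solve-∀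

    Factored : ℕ → ℕ → Set
    Factored u v = (ℓ ∣ᵢ + u * + v - k) × ¬ ℓ ∣ᵢ (+ u - + 1) * (+ v - + 1)

    factored? : ∀ u v → Dec (Factored u v)
    factored? u v = (ℓ ∣ᵢ? + u * + v - k) ×-dec ¬? (ℓ ∣ᵢ? (+ u - + 1) * (+ v - + 1))

    solutions≡∑²factored : solutions ℓ ≡ ∑² ℓ (λ u v → 𝟙 (factored? u v))
    solutions≡∑²factored = trans (∑-cong ℓ (λ x _ → ∑-cong ℓ (λ y _ →
        𝟙-cong (isSolution? ℓ (+ x) (+ y)) (factored? (φ₁ x y) (φ₂ x y))
          (λ (ℓ∣N-k , ℓ∤N-1) → ∣-resp-≈ (N-k≈ x y) ℓ∣N-k , λ ℓ∣ → ℓ∤N-1 (∣-resp-≈ (≈-sym (N-1≈ x y)) ℓ∣))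
          (λ (ℓ∣uv-k , ℓ∤uv-1) → ∣-resp-≈ (≈-sym (N-k≈ x y)) ℓ∣uv-k , λ ℓ∣ → ℓ∤uv-1 (∣-resp-≈ (N-1≈ x y) ℓ∣)))))
      (∑²-substitute (λ u v → 𝟙 (factored? u v)))
      where
      φ≈ : ∀ α x y → + 1 * (+ 1 * + x + α * + y) ≈ + x + α * + y
      φ≈ α x y = ≈-reflexive (trans (ℤₚ.*-identityˡ _) (cong (_+ α * + y) (ℤₚ.*-identityˡ (+ x))))
      φ-1≈ : ∀ α x y → + 1 * (+ 1 * + x + α * + y) - + 1 ≈ (+ x - + 1) + α * (+ y - + 0)
      φ-1≈ α x y = ≈-reflexive (shift α (+ x) (+ y))
        where shift : ∀ α x y → + 1 * (+ 1 * x + α * y) - + 1 ≡ (x - + 1) + α * (y - + 0)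
              shift = solve-∀
      N-k≈ : ∀ x y → N (+ x) (+ y) - k ≈ + φ₁ x y * + φ₂ x y - k
      N-k≈ x y = -‿cong (≈-trans (norm≈product (+ x) (+ y))
        (≈-sym (*-cong (≈-trans (substitute≈ (+ 1) (+ 1) r x y) (φ≈ r x y)) (≈-trans (substitute≈ (+ 1) (+ 1) r′ x y) (φ≈ r′ x y))))) (≈-refl {k})
      N-1≈ : ∀ x y → N (+ x - + 1) (+ y - + 0) ≈ (+ φ₁ x y - + 1) * (+ φ₂ x y - + 1)
      N-1≈ x y = ≈-trans (norm≈product (+ x - + 1) (+ y - + 0))
        (≈-sym (*-cong (≈-trans (-‿cong (substitute≈ (+ 1) (+ 1) r x y) (≈-refl {+ 1})) (φ-1≈ r x y))
                       (≈-trans (-‿cong (substitute≈ (+ 1) (+ 1) r′ x y) (≈-refl {+ 1})) (φ-1≈ r′ x y))))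

    row : ℕ → ℕ
    row u = ∑ ℓ (λ v → 𝟙 (factored? u v))

    row-0 : row 0 ≡ 0
    row-0 = ∑-zero ℓ _ (λ v _ → 𝟙-no (factored? 0 v) (λ (ℓ∣0v-k , _) → ℓ∤k (∣-subst (negate (+ v) k) (∣-neg ℓ∣0v-k))))
      where negate : ∀ v k → - (+ 0 * v - k) ≡ k
            negate = solve-∀

    row-1 : row 1 ≡ 0
    row-1 = ∑-zero ℓ _ (λ v _ → 𝟙-no (factored? 1 v) (λ (_ , ℓ∤0) → ℓ∤0 (∣-subst (sym (vanish (+ v))) (∣-zero ℓ))))
      where vanish : ∀ v → (+ 1 - + 1) * (v - + 1) ≡ + 0
            vanish = solve-∀

    -- For a unit u ≠ 1, the row has the single candidate v = k / u, excluded exactly when v = 1, i.e. u = k.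
    row-≥2 : ∀ u → 2 ≤ u → u < ℓ → row u ≡ 𝟙 (¬? (ℓ ∣ᵢ? + u - k))
    row-≥2 u 2≤u u<ℓ = count (ℓ ∣ᵢ? + u - k)
      where
      ℓ∤u : ¬ ℓ ∣ᵢ + u
      ℓ∤u ℓ∣u = ∤-< ℓ u<ℓ (ℕₚ.≤-<-trans z≤n u<ℓ) (λ u≡0 → ℕₚ.<⇒≢ (ℕₚ.<-trans (s≤s z≤n) 2≤u) (sym u≡0)) (∣-subst (sym (ℤₚ.+-identityʳ (+ u))) ℓ∣u)
      ℓ∤u-1 : ¬ ℓ ∣ᵢ + u - + 1
      ℓ∤u-1 = ∤-< ℓ u<ℓ (ℕₚ.<-trans 2≤u u<ℓ) (λ u≡1 → ℕₚ.<⇒≢ 2≤u (sym u≡1))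
      commute : ∀ u v k → - k + u * v ≡ u * v - k
      commute = solve-∀
      count : (ℓ∣u-k? : Dec (ℓ ∣ᵢ + u - k)) → row u ≡ 𝟙 (¬? ℓ∣u-k?)
      count (yes ℓ∣u-k) = ∑-zero ℓ _ (λ v _ → 𝟙-no (factored? u v) (λ (ℓ∣uv-k , ℓ∤[u-1][v-1]) →
          ℓ∤[u-1][v-1] (∣-*ˡ (+ u - + 1) (∣*∤⇒∣ ℓ-prime (+ u) (+ v - + 1)
            (∣-subst (difference (+ u) (+ v) k) (∣-+ ℓ∣uv-k (∣-neg ℓ∣u-k))) ℓ∤u))))
        where difference : ∀ u v k → u * v - k + - (u - k) ≡ u * (v - + 1)
              difference = solve-∀
      count (no ℓ∤u-k) = trans (∑-cong ℓ (λ v _ → 𝟙-cong (factored? u v) (ℓ ∣ᵢ? - k + + u * + v)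
            (λ (ℓ∣uv-k , _) → ∣-subst (sym (commute (+ u) (+ v) k)) ℓ∣uv-k)
            (λ ℓ∣-k+uv → ∣-subst (commute (+ u) (+ v) k) ℓ∣-k+uv , λ ℓ∣[u-1][v-1] → ℓ∤u-k (∣-subst (difference (+ u) (+ v) k)
                (∣-+ (∣-subst (commute (+ u) (+ v) k) ℓ∣-k+uv)
                     (∣-neg (∣-*ˡ (+ u) (∣*∤⇒∣ ℓ-prime (+ u - + 1) (+ v - + 1) ℓ∣[u-1][v-1] ℓ∤u-1))))))))
          (∑-linear (- k) (+ u) ℓ∤u)
        where difference : ∀ u v k → u * v - k + - (u * (v - + 1)) ≡ u - k
              difference = solve-∀

    private
      2≤ℓ : 2 ≤ ℓ
      2≤ℓ = ℕ.nonTrivial⇒n>1 ℓ {{prime⇒nonTrivial ℓ-prime}}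

      2+n≡ℓ : 2 ℕ.+ (ℓ ∸ 2) ≡ ℓ
      2+n≡ℓ = ℕₚ.m+[n∸m]≡n 2≤ℓ

      2+i<ℓ : ∀ {i} → i < ℓ ∸ 2 → 2 ℕ.+ i < ℓ
      2+i<ℓ i<n = subst (2 ℕ.+ _ <_) 2+n≡ℓ (ℕₚ.+-monoʳ-< 2 i<n)

      Hit : ℕ → Set
      Hit i = ℓ ∣ᵢ + (2 ℕ.+ i) - k

      hit? : ∀ i → Dec (Hit i)
      hit? i = ℓ ∣ᵢ? + (2 ℕ.+ i) - k

    solutions≡misses : solutions ℓ ≡ ∑ (ℓ ∸ 2) (λ i → 𝟙 (¬? (hit? i)))
    solutions≡misses = begin
      solutions ℓ                                          ≡⟨ solutions≡∑²factored ⟩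
      ∑ ℓ row                                              ≡⟨ cong (λ n → ∑ n row) 2+n≡ℓ ⟨
      row 0 ℕ.+ (row 1 ℕ.+ ∑ (ℓ ∸ 2) (λ i → row (2 ℕ.+ i))) ≡⟨ cong₂ (λ a b → a ℕ.+ (b ℕ.+ ∑ (ℓ ∸ 2) (λ i → row (2 ℕ.+ i)))) row-0 row-1 ⟩
      ∑ (ℓ ∸ 2) (λ i → row (2 ℕ.+ i))                      ≡⟨ ∑-cong (ℓ ∸ 2) (λ i i<n → row-≥2 (2 ℕ.+ i) (ℕₚ.m≤m+n 2 i) (2+i<ℓ i<n)) ⟩
      ∑ (ℓ ∸ 2) (λ i → 𝟙 (¬? (hit? i)))                    ∎
      where open ≡-Reasoning

    solutions-split-k≡1 : ℓ ∣ᵢ k - + 1 → solutions ℓ ≡ ℓ ∸ 2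
    solutions-split-k≡1 ℓ∣k-1 = trans solutions≡misses (trans
      (∑-cong (ℓ ∸ 2) (λ i i<n → 𝟙-yes (¬? (hit? i)) (λ ℓ∣2+i-k →
        ∤-< ℓ (2+i<ℓ i<n) 2≤ℓ (λ ()) (∣-subst (telescope (+ (2 ℕ.+ i)) k) (∣-+ ℓ∣2+i-k ℓ∣k-1)))))
      (trans (∑-const (ℓ ∸ 2) 1) (ℕₚ.*-identityʳ (ℓ ∸ 2))))
      where telescope : ∀ a k → a - k + (k - + 1) ≡ a - + 1
            telescope = solve-∀

    -- Exactly one u in [2, ℓ) is congruent to k, namely the residue of k.
    solutions-split-k≢1 : ¬ ℓ ∣ᵢ k - + 1 → solutions ℓ ≡ ℓ ∸ 3
    solutions-split-k≢1 ℓ∤k-1 = begin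
      solutions ℓ                                                       ≡⟨ solutions≡misses ⟩
      misses                                                            ≡⟨ ℕₚ.m+n∸n≡m misses 1 ⟨
      misses ℕ.+ 1 ∸ 1                                                  ≡⟨ cong (λ h → misses ℕ.+ h ∸ 1) one-hit ⟨
      misses ℕ.+ ∑ (ℓ ∸ 2) (λ i → 𝟙 (hit? i)) ∸ 1                      ≡⟨ cong (_∸ 1) (∑-𝟙-¬ (ℓ ∸ 2) hit?) ⟩
      ℓ ∸ 2 ∸ 1                                                         ≡⟨ ℕₚ.∸-+-assoc ℓ 2 1 ⟩
      ℓ ∸ 3                                                             ∎
      where
      open ≡-Reasoning
      misses : ℕ
      misses = ∑ (ℓ ∸ 2) (λ i → 𝟙 (¬? (hit? i)))
      ρ : ℕ
      ρ = k %ℕ ℓ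
      2≤ρ : 2 ≤ ρ
      2≤ρ with k %ℕ ℓ | %ℕ≈ k
      ... | 0           | 0≈k = ⊥-elim (ℓ∤k (≈0⇒∣ (≈-sym 0≈k)))
      ... | 1           | 1≈k = ⊥-elim (ℓ∤k-1 (∣-difference (≈-sym 1≈k)))
      ... | suc (suc _) | _   = s≤s (s≤s z≤n)
      j : ℕ
      j = ρ ∸ 2
      hit-j : Hit j
      hit-j = subst (λ t → ℓ ∣ᵢ + t - k) (sym (ℕₚ.m+[n∸m]≡n 2≤ρ)) (∣-difference (%ℕ≈ k))
      unique : ∀ i → i < ℓ ∸ 2 → Hit i → i ≡ j
      unique i i<n ℓ∣2+i-k = ℕₚ.+-cancelˡ-≡ 2 i j (∣-<⇒≡ ℓ (2+i<ℓ i<n) (2+i<ℓ (ℕₚ.∸-monoˡ-< (n%ℕd<d k ℓ) 2≤ρ))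
        (∣-subst (difference (+ (2 ℕ.+ i)) (+ (2 ℕ.+ j)) k) (∣-+ ℓ∣2+i-k (∣-neg hit-j))))
        where difference : ∀ a b k → a - k + - (b - k) ≡ a - b
              difference = solve-∀
      one-hit : ∑ (ℓ ∸ 2) (λ i → 𝟙 (hit? i)) ≡ 1
      one-hit = ∑-𝟙-unique (ℓ ∸ 2) hit? j (ℕₚ.∸-monoˡ-< (n%ℕd<d k ℓ) 2≤ρ) hit-j unique

module NormSurjectivity where

  open import Data.Integer using (ℤ; +_; _+_; _-_; _*_; -_)
  import Data.Integer.Properties as ℤₚ
  open import Data.Integer.DivMod using (n%ℕd<d)
  import Data.Nat as ℕ
  open ℕ using (ℕ; suc; NonZero; _<_; z<s; s≤s)
  import Data.Nat.Properties as ℕₚ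
  open import Data.Nat.Primality using (Prime; prime⇒nonZero)
  open import Data.Fin as Fin using (Fin; toℕ; fromℕ<)
  import Data.Fin.Properties as Finₚ
  open import Data.Integer.Tactic.RingSolver using (solve-∀)
  open import Relation.Binary.PropositionalEquality
  open import Relation.Nullary using (¬_)
  open import Data.Empty using (⊥-elim)
  open import Data.Sum using (_⊎_; inj₁; inj₂)
  open import Data.Product using (_,_; Σ)
  open IntegerDivisibility
  open HenselLifting using (norm; discriminant)
  open import Data.Integer.Divisibility.Signed using (∣-refl)

  module _ (s c : ℤ) (ℓ : ℕ) (ℓ-prime : Prime ℓ) (ℓ∤disc : ¬ ℓ ∣ᵢ discriminant s c)
           (h : ℕ) (ℓ≡2h+1 : ℓ ≡ suc (h ℕ.+ h)) where

    private
      instance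
        ℓ≢0 : NonZero ℓ
        ℓ≢0 = prime⇒nonZero ℓ-prime
      open Congruence ℓ
      disc : ℤ
      disc = discriminant s c
      H : ℕ
      H = suc h

      H<ℓ : ∀ {a} → a < H → a < ℓ
      H<ℓ {a} a<H = subst (a <_) (sym ℓ≡2h+1) (ℕₚ.<-≤-trans a<H (s≤s (ℕₚ.m≤m+n h h)))

      2H≈1 : + 2 * + H ≈ + 1
      2H≈1 = mod∣ (∣-subst (sym 2H-1≡ℓ) ∣-refl)
        where
        open ≡-Reasoning
        rearrange : ∀ h → + 2 * (+ 1 + h) - + 1 ≡ + 1 + (h + h)
        rearrange = solve-∀
        2H-1≡ℓ : + 2 * + H - + 1 ≡ + ℓ
        2H-1≡ℓ = begin
          + 2 * + H - + 1              ≡⟨ cong (λ z → + 2 * z - + 1) (ℤₚ.pos-+ 1 h) ⟩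
          + 2 * (+ 1 + + h) - + 1      ≡⟨ rearrange (+ h) ⟩
          + 1 + (+ h + + h)            ≡⟨ cong (λ z → + 1 + z) (ℤₚ.pos-+ h h) ⟨
          + 1 + + (h ℕ.+ h)            ≡⟨ ℤₚ.pos-+ 1 (h ℕ.+ h) ⟨
          + suc (h ℕ.+ h)              ≡⟨ cong +_ ℓ≡2h+1 ⟨
          + ℓ                          ∎

      -- a² ≡ a′² forces a ≡ ± a′, and a + a′ < ℓ rules out the minus sign unless a = a′ = 0.
      squares-injective : ∀ a a′ → a < H → a′ < H → ℓ ∣ᵢ + a * + a - + a′ * + a′ → a ≡ a′
      squares-injective a a′ a<H a′<H ℓ∣a²-a′² =
        by-factor (euclidsLemmaℤ ℓ-prime (+ a - + a′) (+ a + + a′) (∣-subst (factor (+ a) (+ a′)) ℓ∣a²-a′²))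
        where
        factor : ∀ a b → a * a - b * b ≡ (a - b) * (a + b)
        factor = solve-∀
        a+a′<ℓ : a ℕ.+ a′ < ℓ
        a+a′<ℓ = subst (a ℕ.+ a′ <_) (sym ℓ≡2h+1) (s≤s (ℕₚ.+-mono-≤ (ℕₚ.≤-pred a<H) (ℕₚ.≤-pred a′<H)))
        by-factor : ℓ ∣ᵢ + a - + a′ ⊎ ℓ ∣ᵢ + a + + a′ → a ≡ a′
        by-factor (inj₁ ℓ∣a-a′) = ∣-<⇒≡ ℓ (H<ℓ a<H) (H<ℓ a′<H) ℓ∣a-a′
        by-factor (inj₂ ℓ∣a+a′) = trans (ℕₚ.m+n≡0⇒m≡0 a a+a′≡0) (sym (ℕₚ.m+n≡0⇒n≡0 a a+a′≡0))
          where
          a+a′≡0 : a ℕ.+ a′ ≡ 0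
          a+a′≡0 = ∣-<⇒≡ ℓ a+a′<ℓ (H<ℓ z<s) (∣-subst (trans (ℤₚ.pos-+ a a′) (sym (ℤₚ.+-identityʳ _))) ℓ∣a+a′)

      halve : ∀ {u v} → + 4 * u ≈ + 4 * v → u ≈ v
      halve {u} {v} 4u≈4v = begin
        u                           ≡⟨ unit u ⟩
        + 1 * + 1 * u               ≈⟨ *-cong (*-cong 2H≈1 2H≈1) (≈-refl {u}) ⟨
        + 2 * + H * (+ 2 * + H) * u ≡⟨ quarter (+ H) u ⟩
        + H * + H * (+ 4 * u)       ≈⟨ *-cong (≈-refl {+ H * + H}) 4u≈4v ⟩
        + H * + H * (+ 4 * v)       ≡⟨ quarter (+ H) v ⟨
        + 2 * + H * (+ 2 * + H) * v ≈⟨ *-cong (*-cong 2H≈1 2H≈1) (≈-refl {v}) ⟩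
        + 1 * + 1 * v               ≡⟨ unit v ⟨
        v                           ∎
        where
        open import Relation.Binary.Reasoning.Setoid ≈-setoid
        unit : ∀ u → u ≡ + 1 * + 1 * u
        unit = solve-∀
        quarter : ∀ h u → + 2 * h * (+ 2 * h) * u ≡ h * h * (+ 4 * u)
        quarter = solve-∀

    module _ (k′ : ℤ) where

      private
        value : Fin H ⊎ Fin H → ℤ
        value (inj₁ a) = + toℕ a * + toℕ a
        value (inj₂ b) = + 4 * k′ + disc * (+ toℕ b * + toℕ b)

        residue : Fin (H ℕ.+ H) → Fin ℓ
        residue i = fromℕ< (n%ℕd<d (value (Fin.splitAt H i)) ℓ)

        residue-injective : ∀ {i j} → residue i ≡ residue j → value (Fin.splitAt H i) ≈ value (Fin.splitAt H j)
        residue-injective {i} {j} eq = ≈-trans (≈-sym (%ℕ≈ (value (Fin.splitAt H i))))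
          (≈-trans (≈-reflexive (cong +_ (trans (sym (Finₚ.toℕ-fromℕ< _)) (trans (cong toℕ eq) (Finₚ.toℕ-fromℕ< _)))))
                   (%ℕ≈ (value (Fin.splitAt H j))))

        -- 4 N (p , q) = (2p + s q)² - disc q², so a² ≡ 4k′ + disc b² is solved by q = b, p = (a - s b) / 2.
        solve : ∀ a b → + a * + a ≈ + 4 * k′ + disc * (+ b * + b) → Σ ℤ λ p → Σ ℤ λ q → ℓ ∣ᵢ norm s c p q - k′
        solve a b a²≈4k′+disc·b² = p , q , ∣-difference (halve (begin
          + 4 * norm s c p q                          ≡⟨ complete-square s c p q ⟩
          (+ 2 * p + s * q) * (+ 2 * p + s * q) - disc * q * q
            ≈⟨ -‿cong (*-cong 2p+sq≈a 2p+sq≈a) (≈-refl {disc * q * q}) ⟩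
          + a * + a - disc * q * q                    ≈⟨ -‿cong a²≈4k′+disc·b² (≈-refl {disc * q * q}) ⟩
          + 4 * k′ + disc * (q * q) - disc * q * q    ≡⟨ cancel (+ 4 * k′) disc q ⟩
          + 4 * k′                                    ∎))
          where
          open import Relation.Binary.Reasoning.Setoid ≈-setoid
          q : ℤ
          q = + b
          p : ℤ
          p = (+ a - s * q) * + H
          complete-square : ∀ s c p q → + 4 * (p * (p + s * q) - c * q * q) ≡ (+ 2 * p + s * q) * (+ 2 * p + s * q) - (s * s + + 4 * c) * q * q
          complete-square = solve-∀
          cancel : ∀ k d b → k + d * (b * b) - d * b * b ≡ k
          cancel = solve-∀
          halve-out : ∀ a s q h → + 2 * ((a - s * q) * h) + s * q ≡ (a - s * q) * (+ 2 * h) + s * q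
          halve-out = solve-∀
          restore : ∀ a b → (a - b) * + 1 + b ≡ a
          restore = solve-∀
          2p+sq≈a : + 2 * p + s * q ≈ + a
          2p+sq≈a = begin
            + 2 * p + s * q                   ≡⟨ halve-out (+ a) s q (+ H) ⟩
            (+ a - s * q) * (+ 2 * + H) + s * q ≈⟨ +-cong (*-cong (≈-refl {+ a - s * q}) 2H≈1) (≈-refl {s * q}) ⟩
            (+ a - s * q) * + 1 + s * q       ≡⟨ restore (+ a) (s * q) ⟩
            + a                               ∎

        collision : ∀ u v → u ≢ v → value u ≈ value v → Σ ℤ λ p → Σ ℤ λ q → ℓ ∣ᵢ norm s c p q - k′
        collision (inj₁ a) (inj₁ a′) a≢a′ a²≈a′² =
          ⊥-elim (a≢a′ (cong inj₁ (Finₚ.toℕ-injective (squares-injective _ _ (Finₚ.toℕ<n a) (Finₚ.toℕ<n a′) (∣-difference a²≈a′²)))))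
        collision (inj₂ b) (inj₂ b′) b≢b′ e =
          ⊥-elim (b≢b′ (cong inj₂ (Finₚ.toℕ-injective (squares-injective _ _ (Finₚ.toℕ<n b) (Finₚ.toℕ<n b′)
            (∣*∤⇒∣ ℓ-prime disc _ (∣-subst (cancel-k (+ 4 * k′) disc _ _) (∣-difference e)) ℓ∤disc)))))
          where cancel-k : ∀ k d a b → (k + d * a) - (k + d * b) ≡ d * (a - b)
                cancel-k = solve-∀
        collision (inj₁ a) (inj₂ b) _ e = solve (toℕ a) (toℕ b) e
        collision (inj₂ b) (inj₁ a) _ e = solve (toℕ a) (toℕ b) (≈-sym e)

        ℓ<H+H : ℓ < H ℕ.+ H
        ℓ<H+H = subst (_< H ℕ.+ H) (sym ℓ≡2h+1) (s≤s (subst (h ℕ.+ h <_) (sym (ℕₚ.+-suc h h)) (ℕₚ.n<1+n _)))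

      -- Pigeonhole: the ℓ + 1 values a² and 4k′ + disc b² (a, b ≤ h) cannot be distinct modulo ℓ.
      norm-onto : Σ ℤ λ p → Σ ℤ λ q → ℓ ∣ᵢ norm s c p q - k′
      norm-onto with Finₚ.pigeonhole ℓ<H+H residue
      ... | i , j , i<j , residue-i≡residue-j = collision (Fin.splitAt H i) (Fin.splitAt H j)
              (λ eq → Finₚ.<⇒≢ i<j (trans (sym (Finₚ.join-splitAt H H i)) (trans (cong (Fin.join H H) eq) (Finₚ.join-splitAt H H j))))
              (residue-injective {i} {j} residue-i≡residue-j)

module InertCount where

  open import Data.Integer using (ℤ; +_; _+_; _-_; _*_; -_)
  import Data.Integer.Properties as ℤₚ
  import Data.Nat as ℕ
  open ℕ using (ℕ; suc; _<_; _∸_; z<s; s<s; z≤n; s≤s)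
  import Data.Nat.Properties as ℕₚ
  open import Data.Nat.Primality using (Prime; prime⇒nonTrivial)
  open import Data.Integer.Tactic.RingSolver using (solve-∀)
  import Data.Nat.Tactic.RingSolver as ℕSolver
  open import Relation.Binary.PropositionalEquality
  open import Relation.Nullary using (Dec; ¬_)
  open import Relation.Nullary.Decidable using (_×-dec_)
  open import Data.Product using (_×_; _,_; proj₁; proj₂; Σ)
  open FiniteSum
  open IntegerDivisibility
  open HenselLifting

  module _ (s c k : ℤ) (ℓ : ℕ) (ℓ-prime : Prime ℓ)
           (ℓ∤disc : ¬ ℓ ∣ᵢ discriminant s c) (ℓ∤k : ¬ ℓ ∣ᵢ k)
           (anisotropic : ∀ x y → ℓ ∣ᵢ norm s c x y → ℓ ∣ᵢ x × ℓ ∣ᵢ y)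
           (norm-onto : ∀ k′ → Σ ℤ λ p → Σ ℤ λ q → ℓ ∣ᵢ norm s c p q - k′) where

    open Solutions s c k ℓ ℓ-prime ℓ∤disc ℓ∤k
    open Congruence ℓ

    representations : ℤ → ℕ
    representations k′ = ∑² ℓ (λ x y → 𝟙 (ℓ ∣ᵢ? N (+ x) (+ y) - k′))

    private
      1<ℓ : 1 < ℓ
      1<ℓ = ℕ.nonTrivial⇒n>1 ℓ {{prime⇒nonTrivial ℓ-prime}}

      0<ℓ : 0 < ℓ
      0<ℓ = ℕₚ.<-trans z<s 1<ℓ

      ∣⇒≡ : ∀ {x} t → x < ℓ → t < ℓ → ℓ ∣ᵢ + x - + t → x ≡ t
      ∣⇒≡ t x<ℓ t<ℓ = ∣-<⇒≡ ℓ x<ℓ t<ℓ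

      u-0≡u : ∀ u → u - + 0 ≡ u
      u-0≡u = ℤₚ.+-identityʳ

    representations-0 : representations (+ 0) ≡ 1
    representations-0 =
      trans (∑-point ℓ _ 0 0<ℓ (λ x x<ℓ x≢0 → ∑-zero ℓ _ (λ y _ → 𝟙-no (ℓ ∣ᵢ? N (+ x) (+ y) - + 0) (λ ℓ∣N →
               x≢0 (∣⇒≡ 0 x<ℓ 0<ℓ (∣-subst (sym (u-0≡u (+ x))) (proj₁ (anisotropic (+ x) (+ y) (∣-subst (u-0≡u _) ℓ∣N)))))))))
     (trans (∑-point ℓ _ 0 0<ℓ (λ y y<ℓ y≢0 → 𝟙-no (ℓ ∣ᵢ? N (+ 0) (+ y) - + 0) (λ ℓ∣N →
               y≢0 (∣⇒≡ 0 y<ℓ 0<ℓ (∣-subst (sym (u-0≡u (+ y))) (proj₂ (anisotropic (+ 0) (+ y) (∣-subst (u-0≡u _) ℓ∣N))))))))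
            (𝟙-yes (ℓ ∣ᵢ? N (+ 0) (+ 0) - + 0) (∣-subst (sym (norm-origin s c)) (∣-zero ℓ))))
      where norm-origin : ∀ s c → + 0 * (+ 0 + s * + 0) - c * + 0 * + 0 - + 0 ≡ + 0
            norm-origin = solve-∀

    -- Multiplication by an element p + q ω of norm k′ is a bijection carrying norm 1 to norm k′.
    representations-unit : ∀ k′ → ¬ ℓ ∣ᵢ k′ → representations k′ ≡ representations (+ 1)
    representations-unit k′ ℓ∤k′ =
      trans (sym (∑²-substitute (λ u v → 𝟙 (ℓ ∣ᵢ? N (+ u) (+ v) - k′))))
        (∑-cong ℓ (λ x _ → ∑-cong ℓ (λ y _ → 𝟙-cong (ℓ ∣ᵢ? N (+ φ₁ x y) (+ φ₂ x y) - k′) (ℓ ∣ᵢ? N (+ x) (+ y) - + 1)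
          (λ ℓ∣Nφ-k′ → ∣*∤⇒∣ ℓ-prime k′ _ (∣-resp-≈ (Nφ-k′≈ x y) ℓ∣Nφ-k′) ℓ∤k′)
          (λ ℓ∣N-1 → ∣-resp-≈ (≈-sym (Nφ-k′≈ x y)) (∣-*ˡ k′ ℓ∣N-1)))))
      where
      p : ℤ
      p = proj₁ (norm-onto k′)
      q : ℤ
      q = proj₁ (proj₂ (norm-onto k′))
      N[p,q]≈k′ : N p q ≈ k′
      N[p,q]≈k′ = mod∣ (proj₂ (proj₂ (norm-onto k′)))
      ℓ∤N[p,q] : ¬ ℓ ∣ᵢ p * (p + s * q) - c * q * q
      ℓ∤N[p,q] ℓ∣N[p,q] = ℓ∤k′ (∣-resp-≈ N[p,q]≈k′ ℓ∣N[p,q])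
      open ChangeOfVariables.Linear ℓ ℓ-prime p (c * q) q (p + s * q) ℓ∤N[p,q]
      multiplicative : ∀ s c p q x y → let u = + 1 * (p * x + c * q * y) ; v = + 1 * (q * x + (p + s * q) * y) in
        u * (u + s * v) - c * v * v ≡ (p * (p + s * q) - c * q * q) * (x * (x + s * y) - c * y * y)
      multiplicative = solve-∀
      Nφ-k′≈ : ∀ x y → N (+ φ₁ x y) (+ φ₂ x y) - k′ ≈ k′ * (N (+ x) (+ y) - + 1)
      Nφ-k′≈ x y = begin
        N (+ φ₁ x y) (+ φ₂ x y) - k′
          ≈⟨ -‿cong (norm-cong ℓ s c (substitute≈ (+ 1) p (c * q) x y) (substitute≈ (+ 1) q (p + s * q) x y)) (≈-refl {k′}) ⟩
        _ ≡⟨ cong (_- k′) (multiplicative s c p q (+ x) (+ y)) ⟩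
        N p q * N (+ x) (+ y) - k′  ≈⟨ -‿cong (*-cong N[p,q]≈k′ (≈-refl {N (+ x) (+ y)})) (≈-refl {k′}) ⟩
        k′ * N (+ x) (+ y) - k′     ≡⟨ factor k′ (N (+ x) (+ y)) ⟩
        k′ * (N (+ x) (+ y) - + 1)  ∎
        where
        open import Relation.Binary.Reasoning.Setoid ≈-setoid
        factor : ∀ k n → k * n - k ≡ k * (n - + 1)
        factor = solve-∀

    ∑-representations : ∑ ℓ (λ j → representations (+ j)) ≡ ℓ ℕ.* ℓ
    ∑-representations = begin
      ∑ ℓ (λ j → ∑ ℓ (λ x → ∑ ℓ (λ y → 𝟙 (ℓ ∣ᵢ? N (+ x) (+ y) - + j))))  ≡⟨ ∑-swap ℓ ℓ _ ⟩
      ∑ ℓ (λ x → ∑ ℓ (λ j → ∑ ℓ (λ y → 𝟙 (ℓ ∣ᵢ? N (+ x) (+ y) - + j))))  ≡⟨ ∑-cong ℓ (λ x _ → ∑-swap ℓ ℓ _) ⟩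
      ∑ ℓ (λ x → ∑ ℓ (λ y → ∑ ℓ (λ j → 𝟙 (ℓ ∣ᵢ? N (+ x) (+ y) - + j))))
        ≡⟨ ∑-cong ℓ (λ x _ → ∑-cong ℓ (λ y _ → trans (∑-cong ℓ (λ j _ →
             𝟙-cong (ℓ ∣ᵢ? N (+ x) (+ y) - + j) (ℓ ∣ᵢ? N (+ x) (+ y) + - + 1 * + j)
               (∣-subst (minus (N (+ x) (+ y)) (+ j))) (∣-subst (sym (minus (N (+ x) (+ y)) (+ j))))))
           (∑-linear (N (+ x) (+ y)) (- + 1) ℓ∤-1))) ⟩
      ∑ ℓ (λ x → ∑ ℓ (λ y → 1))                                          ≡⟨ ∑-cong ℓ (λ x _ → trans (∑-const ℓ 1) (ℕₚ.*-identityʳ ℓ)) ⟩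
      ∑ ℓ (λ x → ℓ)                                                      ≡⟨ ∑-const ℓ ℓ ⟩
      ℓ ℕ.* ℓ                                                            ∎
      where
      open ≡-Reasoning
      minus : ∀ n j → n - j ≡ n + - + 1 * j
      minus = solve-∀
      ℓ∤-1 : ¬ ℓ ∣ᵢ - + 1
      ℓ∤-1 ℓ∣-1 = ∤-< ℓ 1<ℓ 0<ℓ (λ ()) (∣-neg ℓ∣-1)

    -- Counting all ℓ² points by their norm: 1 + (ℓ - 1) · representations 1 = ℓ².
    representations-1 : representations (+ 1) ≡ ℓ ℕ.+ 1
    representations-1 = subst (λ ℓ′ → representations (+ 1) ≡ ℓ′ ℕ.+ 1) 1+p≡ℓ
      (ℕₚ.*-cancelˡ-≡ _ _ p {{ℕ.>-nonZero (ℕₚ.∸-monoˡ-< 1<ℓ (s≤s z≤n))}} (ℕₚ.suc-injective (begin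
        suc (p ℕ.* representations (+ 1))                        ≡⟨ cong suc (∑-const p _) ⟨
        suc (∑ p (λ _ → representations (+ 1)))                  ≡⟨ cong suc (∑-cong p (λ i i<p → representations-unit (+ suc i) (ℓ∤suc i<p))) ⟨
        suc (∑ p (λ i → representations (+ suc i)))              ≡⟨ cong (ℕ._+ ∑ p (λ i → representations (+ suc i))) representations-0 ⟨
        ∑ (suc p) (λ j → representations (+ j))                  ≡⟨ cong (λ n → ∑ n (λ j → representations (+ j))) 1+p≡ℓ ⟩
        ∑ ℓ (λ j → representations (+ j))                        ≡⟨ ∑-representations ⟩
        ℓ ℕ.* ℓ                                                  ≡⟨ cong (λ n → n ℕ.* n) 1+p≡ℓ ⟨
        suc p ℕ.* suc p                                          ≡⟨ square p ⟩
        suc (p ℕ.* (suc p ℕ.+ 1))                                ∎)))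
      where
      open ≡-Reasoning
      p : ℕ
      p = ℓ ∸ 1
      1+p≡ℓ : suc p ≡ ℓ
      1+p≡ℓ = ℕₚ.m+[n∸m]≡n 0<ℓ
      ℓ∤suc : ∀ {i} → i < p → ¬ ℓ ∣ᵢ + suc i
      ℓ∤suc {i} i<p ℓ∣1+i = ∤-< ℓ (subst (suc i <_) 1+p≡ℓ (s<s i<p)) 0<ℓ (λ ()) (∣-subst (sym (u-0≡u (+ suc i))) ℓ∣1+i)
      square : ∀ p → suc p ℕ.* suc p ≡ suc (p ℕ.* (suc p ℕ.+ 1))
      square = ℕSolver.solve-∀

    -- Among the points of norm k, the only one with N (g - 1) ≡ 0 is g = 1.
    solutions+𝟙≡representations : solutions ℓ ℕ.+ 𝟙 (ℓ ∣ᵢ? + 1 - k) ≡ representations k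
    solutions+𝟙≡representations = begin
      solutions ℓ ℕ.+ 𝟙 (ℓ ∣ᵢ? + 1 - k)                            ≡⟨ cong (solutions ℓ ℕ.+_) only-one ⟨
      solutions ℓ ℕ.+ ∑² ℓ (λ x y → 𝟙 (norm-k? x y ×-dec N-1≡0? x y)) ≡⟨ ∑-+ ℓ _ _ ⟨
      _                                                             ≡⟨ ∑-cong ℓ (λ x _ → trans (sym (∑-+ ℓ _ _))
                                                                         (∑-cong ℓ (λ y _ → 𝟙-×¬+𝟙-× (norm-k? x y) (N-1≡0? x y)))) ⟩
      representations k                                             ∎
      where
      open ≡-Reasoning
      norm-k? : ∀ x y → Dec (ℓ ∣ᵢ N (+ x) (+ y) - k)
      norm-k? x y = ℓ ∣ᵢ? N (+ x) (+ y) - k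
      N-1≡0? : ∀ x y → Dec (ℓ ∣ᵢ N (+ x - + 1) (+ y - + 0))
      N-1≡0? x y = ℓ ∣ᵢ? N (+ x - + 1) (+ y - + 0)
      norm-one : ∀ s c → + 1 * (+ 1 + s * + 0) - c * + 0 * + 0 ≡ + 1
      norm-one = solve-∀
      norm-zero : ∀ s c → (+ 1 - + 1) * ((+ 1 - + 1) + s * (+ 0 - + 0)) - c * (+ 0 - + 0) * (+ 0 - + 0) ≡ + 0
      norm-zero = solve-∀
      only-one : ∑² ℓ (λ x y → 𝟙 (norm-k? x y ×-dec N-1≡0? x y)) ≡ 𝟙 (ℓ ∣ᵢ? + 1 - k)
      only-one =
        trans (∑-point ℓ _ 1 1<ℓ (λ x x<ℓ x≢1 → ∑-zero ℓ _ (λ y _ → 𝟙-no (norm-k? x y ×-dec N-1≡0? x y) (λ (_ , ℓ∣N-1) →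
                 x≢1 (∣⇒≡ 1 x<ℓ 1<ℓ (proj₁ (anisotropic (+ x - + 1) (+ y - + 0) ℓ∣N-1)))))))
       (trans (∑-point ℓ _ 0 0<ℓ (λ y y<ℓ y≢0 → 𝟙-no (norm-k? 1 y ×-dec N-1≡0? 1 y) (λ (_ , ℓ∣N-1) →
                 y≢0 (∣⇒≡ 0 y<ℓ 0<ℓ (proj₂ (anisotropic (+ 1 - + 1) (+ y - + 0) ℓ∣N-1))))))
              (𝟙-cong (norm-k? 1 0 ×-dec N-1≡0? 1 0) (ℓ ∣ᵢ? + 1 - k)
                 (λ (ℓ∣N-k , _) → ∣-subst (cong (_- k) (norm-one s c)) ℓ∣N-k)
                 (λ ℓ∣1-k → ∣-subst (cong (_- k) (sym (norm-one s c))) ℓ∣1-k , ∣-subst (sym (norm-zero s c)) (∣-zero ℓ))))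

    solutions-inert-k≡1 : ℓ ∣ᵢ k - + 1 → solutions ℓ ≡ ℓ
    solutions-inert-k≡1 ℓ∣k-1 = ℕₚ.+-cancelʳ-≡ 1 (solutions ℓ) ℓ (begin
      solutions ℓ ℕ.+ 1                    ≡⟨ cong (solutions ℓ ℕ.+_) (𝟙-yes (ℓ ∣ᵢ? + 1 - k) (∣-subst (negate k (+ 1)) (∣-neg ℓ∣k-1))) ⟨
      solutions ℓ ℕ.+ 𝟙 (ℓ ∣ᵢ? + 1 - k)    ≡⟨ solutions+𝟙≡representations ⟩
      representations k                    ≡⟨ representations-unit k ℓ∤k ⟩
      representations (+ 1)                ≡⟨ representations-1 ⟩
      ℓ ℕ.+ 1                              ∎)
      where
      open ≡-Reasoning
      negate : ∀ u v → - (u - v) ≡ v - u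
      negate = solve-∀

    solutions-inert-k≢1 : ¬ ℓ ∣ᵢ k - + 1 → solutions ℓ ≡ ℓ ℕ.+ 1
    solutions-inert-k≢1 ℓ∤k-1 = begin
      solutions ℓ                          ≡⟨ ℕₚ.+-identityʳ (solutions ℓ) ⟨
      solutions ℓ ℕ.+ 0                    ≡⟨ cong (solutions ℓ ℕ.+_) (𝟙-no (ℓ ∣ᵢ? + 1 - k) (λ ℓ∣1-k → ℓ∤k-1 (∣-subst (negate (+ 1) k) (∣-neg ℓ∣1-k)))) ⟨
      solutions ℓ ℕ.+ 𝟙 (ℓ ∣ᵢ? + 1 - k)    ≡⟨ solutions+𝟙≡representations ⟩
      representations k                    ≡⟨ representations-unit k ℓ∤k ⟩
      representations (+ 1)                ≡⟨ representations-1 ⟩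
      ℓ ℕ.+ 1                              ∎
      where
      open ≡-Reasoning
      negate : ∀ u v → - (u - v) ≡ v - u
      negate = solve-∀

module Decomposition where

  open import Defs
  open import Data.Integer using (ℤ; +_; _+_; _-_; _*_; -_; _%ℕ_)
  import Data.Integer.Properties as ℤₚ
  open import Data.Integer.DivMod using (n%ℕd<d)
  open import Data.Integer.Divisibility.Signed using (∣ᵤ⇒∣; ∣⇒∣ᵤ)
  import Data.Nat as ℕ
  open ℕ using (ℕ; suc; z≤n; s≤s)
  import Data.Nat.Properties as ℕₚ
  import Data.Nat.Divisibility as ℕ∣
  import Data.Nat.DivMod as ℕ%
  open import Data.Nat.Primality using (Prime; prime⇒nonZero; prime⇒nonTrivial)
  open import Data.Fin using (Fin; toℕ; fromℕ<)
  import Data.Fin.Properties as Finₚ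
  open import Data.Integer.Tactic.RingSolver using (solve-∀)
  open import Relation.Binary.PropositionalEquality
  open import Relation.Nullary using (¬_; Dec; yes; no)
  open import Data.Empty using (⊥-elim)
  open import Data.Sum using (_⊎_; inj₁; inj₂)
  open import Data.Product using (_×_; _,_; proj₁; proj₂; ∃; Σ)
  open IntegerDivisibility
  open HenselLifting using (norm; discriminant)

  module _ (d : ℤ) (ℓ : ℕ) (ℓ-prime : Prime ℓ) (ℓ-odd : ¬ 2 ℕ∣.∣ ℓ) where

    private
      s : ℤ
      s = ωs d
      c : ℤ
      c = ωc d
      instance
        ℓ≢0 : ℕ.NonZero ℓ
        ℓ≢0 = prime⇒nonZero ℓ-prime

      ∣O⇒∣ : ∀ x y → ℓ ∣O (x , y) → ℓ ∣ᵢ x × ℓ ∣ᵢ y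
      ∣O⇒∣ x y (ℓ∣x , ℓ∣y) = ∣ᵤ⇒∣ {i = x} ℓ∣x , ∣ᵤ⇒∣ {i = y} ℓ∣y

      ∣⇒∣O : ∀ x y → ℓ ∣ᵢ x → ℓ ∣ᵢ y → ℓ ∣O (x , y)
      ∣⇒∣O x y ℓ∣x ℓ∣y = ∣⇒∣ᵤ ℓ∣x , ∣⇒∣ᵤ ℓ∣y

      ℓ∤2 : ¬ ℓ ∣ᵢ + 2
      ℓ∤2 ℓ∣2 = ℓ-odd (subst (2 ℕ∣.∣_) (ℕₚ.≤-antisym (ℕ.nonTrivial⇒n>1 ℓ {{prime⇒nonTrivial ℓ-prime}}) (ℕ∣.∣⇒≤ (∣⇒∣ᵤ ℓ∣2)))
                                    ℕ∣.∣-refl)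

    -- (2ω - s)² = disc, so ℓ ∣ disc would make 2ω - s nilpotent modulo ℓ.
    unramified⇒ℓ∤disc : Unramified d ℓ → ¬ ℓ ∣ᵢ discriminant s c
    unramified⇒ℓ∤disc unramified ℓ∣disc =
      ℓ∤2 (proj₂ (∣O⇒∣ (- s) (+ 2) (unramified (- s , + 2) (∣⇒∣O _ _ (∣-subst (sym (square₁ s c)) ℓ∣disc) (∣-subst (sym (square₂ s)) (∣-zero ℓ))))))
      where
      square₁ : ∀ s c → - s * - s + c * + 2 * + 2 ≡ s * s + + 4 * c
      square₁ = solve-∀
      square₂ : ∀ s → - s * + 2 + - s * + 2 + s * + 2 * + 2 ≡ + 0
      square₂ = solve-∀

    -- (x + y ω)(x + s y - y ω) = N (x , y).
    inert⇒anisotropic : Inert d ℓ → ∀ x y → ℓ ∣ᵢ norm s c x y → ℓ ∣ᵢ x × ℓ ∣ᵢ y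
    inert⇒anisotropic inert x y ℓ∣N = from-factor (inert (x , y) (x + s * y , - y)
      (∣⇒∣O _ _ (∣-subst (sym (conjugate₁ s c x y)) ℓ∣N) (∣-subst (sym (conjugate₂ s x y)) (∣-zero ℓ))))
      where
      conjugate₁ : ∀ s c x y → x * (x + s * y) + c * y * - y ≡ x * (x + s * y) - c * y * y
      conjugate₁ = solve-∀
      conjugate₂ : ∀ s x y → x * - y + (x + s * y) * y + s * y * - y ≡ + 0
      conjugate₂ = solve-∀
      cancel : ∀ s x y → x + s * y + - (s * y) ≡ x
      cancel = solve-∀
      from-factor : ℓ ∣O (x , y) ⊎ ℓ ∣O (x + s * y , - y) → ℓ ∣ᵢ x × ℓ ∣ᵢ y
      from-factor (inj₁ ℓ∣g) = ∣O⇒∣ x y ℓ∣g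
      from-factor (inj₂ ℓ∣ḡ) = let ℓ∣x+sy , ℓ∣-y = ∣O⇒∣ (x + s * y) (- y) ℓ∣ḡ
                                   ℓ∣y = ∣-subst (ℤₚ.neg-involutive y) (∣-neg ℓ∣-y) in
        ∣-subst (cancel s x y) (∣-+ ℓ∣x+sy (∣-neg (∣-*ˡ s ℓ∣y))) , ℓ∣y

    private
      f : ℤ → ℤ
      f u = u * u - s * u - c

      Root : Set
      Root = ∃ λ (r : Fin ℓ) → ℓ ∣ᵢ f (+ toℕ r)

      root? : Dec Root
      root? = Finₚ.any? (λ r → ℓ ∣ᵢ? f (+ toℕ r))

      -- If y is a unit, then N (x , y) = y² f (- x / y); so without a root of f, ℓ ∣ N forces ℓ ∣ y and then ℓ ∣ x.
      no-root⇒anisotropic : ¬ Root → ∀ x y → ℓ ∣ᵢ norm s c x y → ℓ ∣ᵢ x × ℓ ∣ᵢ y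
      no-root⇒anisotropic no-root x y ℓ∣N = by-cases (ℓ ∣ᵢ? y)
        where
        cancel₁ : ∀ s c x y → x * (x + s * y) - c * y * y + c * (y * y) ≡ x * (x + s * y)
        cancel₁ = solve-∀
        cancel₂ : ∀ s x y → x + s * y + - (s * y) ≡ x
        cancel₂ = solve-∀
        dehomogenize : ∀ s c x y w → y * (y * ((- x * w) * (- x * w) - s * (- x * w) - c))
          ≡ (x * (x + s * y) - c * y * y) + (y * w - + 1) * (x * x * (y * w + + 1) + s * x * y)
        dehomogenize = solve-∀

        ℓ∣x : ℓ ∣ᵢ y → ℓ ∣ᵢ x
        ℓ∣x ℓ∣y = from-factor (euclidsLemmaℤ ℓ-prime x (x + s * y) (∣-subst (cancel₁ s c x y) (∣-+ ℓ∣N (∣-*ˡ c (∣-*ˡ y ℓ∣y)))))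
          where
          from-factor : ℓ ∣ᵢ x ⊎ ℓ ∣ᵢ x + s * y → ℓ ∣ᵢ x
          from-factor (inj₁ ℓ∣x)    = ℓ∣x
          from-factor (inj₂ ℓ∣x+sy) = ∣-subst (cancel₂ s x y) (∣-+ ℓ∣x+sy (∣-neg (∣-*ˡ s ℓ∣y)))

        root : ¬ ℓ ∣ᵢ y → Root
        root ℓ∤y = fromℕ< (n%ℕd<d r ℓ) , ∣-subst (cong f (cong +_ (sym (Finₚ.toℕ-fromℕ< (n%ℕd<d r ℓ))))) ℓ∣f[r%ℓ]
          where
          open Congruence ℓ
          y⁻¹ : ℤ
          y⁻¹ = proj₁ (inverse-mod-prime ℓ-prime y ℓ∤y)
          r : ℤ
          r = - x * y⁻¹
          ℓ∣f[r] : ℓ ∣ᵢ f r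
          ℓ∣f[r] = ∣*∤⇒∣ ℓ-prime y (f r) (∣*∤⇒∣ ℓ-prime y (y * f r)
            (∣-subst (sym (dehomogenize s c x y y⁻¹)) (∣-+ ℓ∣N (∣-* _ (proj₂ (inverse-mod-prime ℓ-prime y ℓ∤y))))) ℓ∤y) ℓ∤y
          ℓ∣f[r%ℓ] : ℓ ∣ᵢ f (+ (r %ℕ ℓ))
          ℓ∣f[r%ℓ] = ∣-resp-≈ (-‿cong (-‿cong (*-cong (≈-sym (%ℕ≈ r)) (≈-sym (%ℕ≈ r))) (*-cong (≈-refl {s}) (≈-sym (%ℕ≈ r)))) (≈-refl {c})) ℓ∣f[r]

        by-cases : Dec (ℓ ∣ᵢ y) → ℓ ∣ᵢ x × ℓ ∣ᵢ y
        by-cases (yes ℓ∣y) = ℓ∣x ℓ∣y , ℓ∣y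
        by-cases (no ℓ∤y)  = ⊥-elim (no-root (root ℓ∤y))

      -- Anisotropy of N makes ℓ prime in O_K, since N is multiplicative.
      anisotropic⇒inert : (∀ x y → ℓ ∣ᵢ norm s c x y → ℓ ∣ᵢ x × ℓ ∣ᵢ y) → Inert d ℓ
      anisotropic⇒inert anisotropic (x₁ , y₁) (x₂ , y₂) ℓ∣αβ =
        from-factor (euclidsLemmaℤ ℓ-prime (norm s c x₁ y₁) (norm s c x₂ y₂) (∣-subst (multiplicative s c x₁ y₁ x₂ y₂) ℓ∣N[αβ]))
        where
        g₁ : ℤ
        g₁ = x₁ * x₂ + c * y₁ * y₂
        g₂ : ℤ
        g₂ = x₁ * y₂ + x₂ * y₁ + s * y₁ * y₂
        ℓ∣N[αβ] : ℓ ∣ᵢ norm s c g₁ g₂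
        ℓ∣N[αβ] = let ℓ∣g₁ , ℓ∣g₂ = ∣O⇒∣ g₁ g₂ ℓ∣αβ in ∣-+ (∣-* (g₁ + s * g₂) ℓ∣g₁) (∣-neg (∣-* g₂ (∣-*ˡ c ℓ∣g₂)))
        multiplicative : ∀ s c x₁ y₁ x₂ y₂ → let g₁ = x₁ * x₂ + c * y₁ * y₂ ; g₂ = x₁ * y₂ + x₂ * y₁ + s * y₁ * y₂ in
          g₁ * (g₁ + s * g₂) - c * g₂ * g₂ ≡ (x₁ * (x₁ + s * y₁) - c * y₁ * y₁) * (x₂ * (x₂ + s * y₂) - c * y₂ * y₂)
        multiplicative = solve-∀
        from-factor : ℓ ∣ᵢ norm s c x₁ y₁ ⊎ ℓ ∣ᵢ norm s c x₂ y₂ → ℓ ∣O (x₁ , y₁) ⊎ ℓ ∣O (x₂ , y₂)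
        from-factor (inj₁ ℓ∣Nα) = inj₁ (let ℓ∣x , ℓ∣y = anisotropic x₁ y₁ ℓ∣Nα in ∣⇒∣O _ _ ℓ∣x ℓ∣y)
        from-factor (inj₂ ℓ∣Nβ) = inj₂ (let ℓ∣x , ℓ∣y = anisotropic x₂ y₂ ℓ∣Nβ in ∣⇒∣O _ _ ℓ∣x ℓ∣y)

    splits⇒root : Splits d ℓ → Σ ℤ λ r → ℓ ∣ᵢ r * r - s * r - c
    splits⇒root (_ , ¬inert) with root?
    ... | yes (r , ℓ∣f[r]) = + toℕ r , ℓ∣f[r]
    ... | no no-root = ⊥-elim (¬inert (anisotropic⇒inert (no-root⇒anisotropic no-root)))

    odd⇒2h+1 : Σ ℕ λ h → ℓ ≡ suc (h ℕ.+ h)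
    odd⇒2h+1 = from-parity (ℓ ℕ.% 2) refl
      where
      h : ℕ
      h = ℓ ℕ./ 2
      from-parity : ∀ r → ℓ ℕ.% 2 ≡ r → Σ ℕ λ h → ℓ ≡ suc (h ℕ.+ h)
      from-parity 0 ℓ%2≡0 = ⊥-elim (ℓ-odd (ℕ∣.m%n≡0⇒n∣m ℓ 2 ℓ%2≡0))
      from-parity 1 ℓ%2≡1 = h , trans (ℕ%.m≡m%n+[m/n]*n ℓ 2)
        (cong₂ ℕ._+_ ℓ%2≡1 (trans (ℕₚ.*-comm h 2) (cong (h ℕ.+_) (ℕₚ.+-identityʳ h))))
      from-parity (suc (suc _)) ℓ%2≡2+ = ⊥-elim (ℕₚ.<⇒≱ (ℕ%.m%n<n ℓ 2) (subst (2 ℕ.≤_) (sym ℓ%2≡2+) (s≤s (s≤s z≤n))))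

open import Defs
open import Data.Nat using (ℕ; _^_; _∸_; _≥_; _+_) renaming (_*_ to _*ℕ_)
open import Data.Nat.Divisibility using (_∣_)
open import Data.Nat.Primality using (Prime; prime⇒nonZero)
open import Data.Nat.Coprimality using (Coprime)
open import Data.Integer using (ℤ; +_; ∣_∣)
open import Data.Product using (_×_; _,_)
open import Relation.Nullary using (¬_)
open import Relation.Binary.PropositionalEquality using (_≡_; trans; cong)

open import Data.Nat using (suc; NonZero)
import Data.Nat.Properties as ℕₚ
open import Data.Integer using (_-_)
open import Data.Product using (Σ)
open IntegerDivisibility using (_∣ᵢ_; coprime⇒∤; %ℕ≡0⇒∣; ∣⇒%ℕ≡0)
open HenselLifting using (norm; discriminant; module Solutions)
open ResidueCount using (countN≡solutions)
open SplitCount using (solutions-split-k≡1; solutions-split-k≢1)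
open InertCount using (solutions-inert-k≡1; solutions-inert-k≢1)
open NormSurjectivity using (norm-onto)
open Decomposition

corollary3p6 : (d : ℤ) → ImagQuadratic d →
    (ℓ : ℕ) (pℓ : Prime ℓ) → ¬ (2 ∣ ℓ) → Unramified d ℓ →
    (a : ℕ) → a ≥ 1 → (k : ℤ) → Coprime ∣ k ∣ ℓ →
    (Splits d ℓ →
      ((_≡[_]_ k ℓ {{prime⇒nonZero pℓ}} (+ 1) →
          countN d ℓ a {{prime⇒nonZero pℓ}} k ≡ ℓ ^ (a ∸ 1) *ℕ (ℓ ∸ 2))
      × (¬ (_≡[_]_ k ℓ {{prime⇒nonZero pℓ}} (+ 1)) →
          countN d ℓ a {{prime⇒nonZero pℓ}} k ≡ ℓ ^ (a ∸ 1) *ℕ (ℓ ∸ 3))))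
    × (Inert d ℓ →
      ((_≡[_]_ k ℓ {{prime⇒nonZero pℓ}} (+ 1) →
          countN d ℓ a {{prime⇒nonZero pℓ}} k ≡ ℓ ^ a)
      × (¬ (_≡[_]_ k ℓ {{prime⇒nonZero pℓ}} (+ 1)) →
          countN d ℓ a {{prime⇒nonZero pℓ}} k ≡ ℓ ^ (a ∸ 1) *ℕ (ℓ + 1))))
corollary3p6 d _ ℓ ℓ-prime ℓ-odd unramified (suc b) _ k coprime = split-case , inert-case
  where
  instance
    ℓ≢0 : NonZero ℓ
    ℓ≢0 = prime⇒nonZero ℓ-prime
  s : ℤ
  s = ωs d
  c : ℤ
  c = ωc d
  ℓ∤disc : ¬ ℓ ∣ᵢ discriminant s c
  ℓ∤disc = unramified⇒ℓ∤disc d ℓ ℓ-prime ℓ-odd unramified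
  ℓ∤k : ¬ ℓ ∣ᵢ k
  ℓ∤k = coprime⇒∤ ℓ-prime k coprime
  open Solutions s c k ℓ ℓ-prime ℓ∤disc ℓ∤k using (solutions; solutions-prime-power)

  reduce : ∀ {n} → solutions ℓ ≡ n → countN d ℓ (suc b) k ≡ ℓ ^ b *ℕ n
  reduce solutions≡n = trans (countN≡solutions d k ℓ ℓ-prime ℓ∤disc ℓ∤k b)
    (trans (solutions-prime-power b) (cong (ℓ ^ b *ℕ_) solutions≡n))

  ℓ∣k-1 : k ≡[ ℓ ] + 1 → ℓ ∣ᵢ k - + 1
  ℓ∣k-1 = %ℕ≡0⇒∣ (k - + 1) ℓ

  ℓ∤k-1 : ¬ k ≡[ ℓ ] + 1 → ¬ ℓ ∣ᵢ k - + 1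
  ℓ∤k-1 k≢1 ℓ∣k-1 = k≢1 (∣⇒%ℕ≡0 (k - + 1) ℓ ℓ∣k-1)

  split-case : Splits d ℓ → (k ≡[ ℓ ] + 1 → countN d ℓ (suc b) k ≡ ℓ ^ b *ℕ (ℓ ∸ 2))
                          × (¬ k ≡[ ℓ ] + 1 → countN d ℓ (suc b) k ≡ ℓ ^ b *ℕ (ℓ ∸ 3))
  split-case split with splits⇒root d ℓ ℓ-prime ℓ-odd split
  ... | r , r-root = (λ k≡1 → reduce (solutions-split-k≡1 s c k ℓ ℓ-prime ℓ∤disc ℓ∤k r r-root (ℓ∣k-1 k≡1)))
                   , (λ k≢1 → reduce (solutions-split-k≢1 s c k ℓ ℓ-prime ℓ∤disc ℓ∤k r r-root (ℓ∤k-1 k≢1)))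

  inert-case : Inert d ℓ → (k ≡[ ℓ ] + 1 → countN d ℓ (suc b) k ≡ ℓ ^ suc b)
                         × (¬ k ≡[ ℓ ] + 1 → countN d ℓ (suc b) k ≡ ℓ ^ b *ℕ (ℓ + 1))
  inert-case inert with odd⇒2h+1 d ℓ ℓ-prime ℓ-odd
  ... | h , ℓ≡2h+1 =
      (λ k≡1 → trans (reduce (solutions-inert-k≡1 s c k ℓ ℓ-prime ℓ∤disc ℓ∤k anisotropic onto (ℓ∣k-1 k≡1))) (ℕₚ.*-comm (ℓ ^ b) ℓ))
    , (λ k≢1 → reduce (solutions-inert-k≢1 s c k ℓ ℓ-prime ℓ∤disc ℓ∤k anisotropic onto (ℓ∤k-1 k≢1)))
    where
    anisotropic : ∀ x y → ℓ ∣ᵢ norm s c x y → ℓ ∣ᵢ x × ℓ ∣ᵢ y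
    anisotropic = inert⇒anisotropic d ℓ ℓ-prime ℓ-odd inert
    onto : ∀ k′ → Σ ℤ λ p → Σ ℤ λ q → ℓ ∣ᵢ norm s c p q - k′
    onto = norm-onto s c ℓ ℓ-prime ℓ∤disc h ℓ≡2h+1
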